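{- Let $p$ be an odd prime, $\omega=e^{2\pi i/p}$, $K=\mathbb{Q}(\omega)$, and for a positive integer $N$ let $$B(p,N)=\Big\{a_1\omega+\cdots+a_{p-1}\omega^{p-1}: a_1,\dots,a_{p-1}\in[-N,N]\cap\mathbb{Z}\Big\}.$$ For any $\varepsilon>0$ there exists an absolute and effectively computable constant $A(\varepsilon)$ such that if $N>A(\varepsilon)$ and $p>A(\varepsilon)$, then $$\frac{1}{\#B(p,N)^{2}}\#\left\{(\alpha,\beta)\in B(p,N)\times B(p,N):\left|\mathfrak{d}_{p,N}(\alpha,\beta)-\frac{1}{\sqrt{6}}\right|>\varepsilon\right\}<\varepsilon.$$
   Context: $\operatorname{Tr}_{K/\mathbb{Q}}(\alpha)=\sum_{\sigma\in\operatorname{Gal}(K/\mathbb{Q})}\sigma(\alpha)$. For $\alpha\in K$, $\|\alpha\|=\sqrt{\sum_{j=1}^{p-1}\operatorname{Tr}_{K/\mathbb{Q}}(\alpha\omega^j)^2}$, and $d(\alpha,\beta)=\|\alpha-\beta\|$. The normalized distance is $\mathfrak{d}_{p,N}(\alpha,\beta)=\dfrac{d(\alpha,\beta)}{2Np\sqrt{p-1}}$.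
   Formalization: The parameter ε ranges over the positive rationals. -}

module Defs where

open import Data.Nat as ℕ using (ℕ; zero; suc)
open import Data.Nat.Divisibility using (_∣?_)
open import Data.Integer as ℤ using (ℤ; +_)
open import Data.Rational as ℚ using (ℚ; 0ℚ; _/_)
open import Data.Rational.Properties using (_<?_)
open import Data.List using (List; []; _∷_; map; concatMap; upTo; length; filter; cartesianProduct; foldr; _++_)
open import Data.Product using (_×_; _,_)
open import Data.Sum using (_⊎_)
open import Relation.Nullary using (Dec; does)
open import Relation.Nullary.Decidable using (_×-dec_; _⊎-dec_)
open import Data.Bool using (if_then_else_)

-- Elements of ℤ[ω] ⊂ K = ℚ(ω), ω = e^{2πi/p}, as formal sums Σ a·ω^i,
-- given as lists of terms (i , a) meaning a·ω^i.

Term : Set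
Term = ℕ × ℤ

Elt : Set
Elt = List Term

negE : Elt → Elt
negE = map (λ { (i , a) → (i , ℤ.- a) })

subE : Elt → Elt → Elt
subE α β = α ++ negE β

mulω : ℕ → Elt → Elt
mulω j = map (λ { (i , a) → (i ℕ.+ j , a) })

σ : ℕ → Elt → Elt
σ k = map (λ { (i , a) → (k ℕ.* i , a) })

sumℤ : List ℤ → ℤ
sumℤ = foldr ℤ._+_ (+ 0)

coeff0 : ℕ → Elt → ℤ
coeff0 p α = sumℤ (map (λ { (i , a) → if does (p ∣? i) then a else + 0 }) α)

-- total coefficient of ω^i over exponents i ≡ 1 (mod p)   (for p ≥ 2)
coeff1 : ℕ → Elt → ℤ
coeff1 p α = sumℤ (map (λ { (i , a) → if does (p ∣? (i ℕ.+ (p ℕ.∸ 1))) then a else + 0 }) α)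

-- The rational number represented by a Galois-invariant element of K:
-- reducing exponents mod p, such an element is c₀ + c·(ω + … + ω^{p-1}) = c₀ - c.
ratValue : ℕ → Elt → ℤ
ratValue p v = coeff0 p v ℤ.- coeff1 p v

galIdx : ℕ → List ℕ
galIdx p = map suc (upTo (p ℕ.∸ 1))

Tr : ℕ → Elt → ℤ
Tr p α = ratValue p (concatMap (λ k → σ k α) (galIdx p))

normSq : ℕ → Elt → ℤ
normSq p α = sumℤ (map (λ j → Tr p (mulω j α) ℤ.* Tr p (mulω j α)) (galIdx p))

range : ℕ → List ℤ
range N = map (λ k → + k ℤ.- + N) (upTo (suc (2 ℕ.* N)))

tuples : ℕ → ℕ → List (List ℤ)
tuples N zero = [] ∷ []
tuples N (suc n) = concatMap (λ a → map (a ∷_) (tuples N n)) (range N)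

toEltFrom : ℕ → List ℤ → Elt
toEltFrom k [] = []
toEltFrom k (a ∷ as) = (k , a) ∷ toEltFrom (suc k) as

toElt : List ℤ → Elt
toElt = toEltFrom 1

-- B(p,N) listed by coefficient tuples (distinct tuples give distinct
-- elements since ω,…,ω^{p-1} is a ℚ-basis of K)
Bset : ℕ → ℕ → List Elt
Bset p N = map toElt (tuples N (p ℕ.∸ 1))

fromℕ : ℕ → ℚ
fromℕ n = + n / 1

fromℤ : ℤ → ℚ
fromℤ z = z / 1

-- 1/m for m > 0 (value at 0 is irrelevant; only used with m > 0)
invℕ : ℕ → ℚ
invℕ zero = 0ℚ
invℕ (suc m) = + 1 / suc m

-- SumLt s e r  ⇔  √s + e < √r   (for s, r, e ≥ 0):
-- √s + e < √r ⇔ s + 2e√s + e² < r ⇔ t > 0 ∧ 4e²s < t²,  t = r - s - e².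
SumLt : ℚ → ℚ → ℚ → Set
SumLt s e r = (0ℚ ℚ.< (r ℚ.- s ℚ.- e ℚ.* e)) ×
              (fromℕ 4 ℚ.* e ℚ.* e ℚ.* s ℚ.< (r ℚ.- s ℚ.- e ℚ.* e) ℚ.* (r ℚ.- s ℚ.- e ℚ.* e))

SumLt? : ∀ s e r → Dec (SumLt s e r)
SumLt? s e r = (0ℚ <? (r ℚ.- s ℚ.- e ℚ.* e)) ×-dec
               (fromℕ 4 ℚ.* e ℚ.* e ℚ.* s <? (r ℚ.- s ℚ.- e ℚ.* e) ℚ.* (r ℚ.- s ℚ.- e ℚ.* e))

-- SqrtFar r s e  ⇔  |√r - √s| > e   (for r, s, e ≥ 0)
SqrtFar : ℚ → ℚ → ℚ → Set
SqrtFar r s e = SumLt s e r ⊎ SumLt r e s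

SqrtFar? : ∀ r s e → Dec (SqrtFar r s e)
SqrtFar? r s e = SumLt? s e r ⊎-dec SumLt? r e s

-- 𝔡_{p,N}(α,β)² = d(α,β)² / (4 N² p² (p-1))
normDistSq : ℕ → ℕ → Elt → Elt → ℚ
normDistSq p N α β =
  fromℤ (normSq p (subE α β)) ℚ.* invℕ (4 ℕ.* (N ℕ.* N) ℕ.* (p ℕ.* p) ℕ.* (p ℕ.∸ 1))

Bad : ℕ → ℕ → ℚ → Elt × Elt → Set
Bad p N ε (α , β) = SqrtFar (normDistSq p N α β) (+ 1 / 6) ε

Bad? : ∀ p N ε → (x : Elt × Elt) → Dec (Bad p N ε x)
Bad? p N ε (α , β) = SqrtFar? (normDistSq p N α β) (+ 1 / 6) ε

badProportion : ℕ → ℕ → ℚ → ℚ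
badProportion p N ε =
  fromℕ (length (filter (Bad? p N ε) (cartesianProduct (Bset p N) (Bset p N))))
  ℚ.* invℕ (length (Bset p N) ℕ.* length (Bset p N))

-- Write α - β = Σᵢ cᵢ ωⁱ with cᵢ = aᵢ - bᵢ.  Since Tr(ωᵐ) = p·[p ∣ m] - 1, the norm is the explicit
-- quadratic form ‖α - β‖² = p² Σ cᵢ² - (p + 1)(Σ cᵢ)², so that with D = 4N²p²(p - 1)
--   D (6 𝔡² - 1) = 2p² Σ hᵢ + 4p²(p - 1)N - 6(p + 1)(Σ cᵢ)²,   hᵢ = 3cᵢ² - 2N(N + 1).
-- For (α, β) uniform on B × B the pairs (aᵢ, bᵢ) are independent and the cᵢ and hᵢ are centred, so the
-- second moment of Σ hᵢ and the fourth moment of Σ cᵢ grow only like n and n² (n = p - 1).  Hence the mean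
-- square of D (6 𝔡² - 1) is small compared with D² once p and N are large, while |𝔡 - 1/√6| > ε
-- forces |6 𝔡² - 1| > 6ε²; Markov's inequality bounds the proportion of such pairs.

module Submission where

open import Defs
open import Data.Bool using (true; false; if_then_else_)
open import Data.Empty using (⊥-elim)
open import Data.Integer as ℤ using (ℤ; +_; -[1+_]; 0ℤ; 1ℤ; _+_; _*_; -_; _-_; _≤_; _<_; +≤+; +<+)
import Data.Integer.Properties as ℤP
open import Data.Integer.Tactic.RingSolver using (solve-∀)
open import Data.List using (List; []; _∷_; [_]; _∷ʳ_; _++_; map; concat; concatMap; length; upTo; cartesianProduct; filter)
open import Data.List.Membership.Propositional using (_∈_)
open import Data.List.Membership.Propositional.Properties using (∈-map⁻; ∈-upTo⁻; ∈-cartesianProduct⁻; ∈-concatMap⁻)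
open import Data.List.Properties using (upTo-∷ʳ; length-map; length-upTo)
open import Data.List.Relation.Unary.Any using (here; there; satisfied)
open import Data.Nat as ℕ using (ℕ; zero; suc; z≤n; s≤s; _∸_)
import Data.Nat.Properties as ℕP
open import Data.Nat.Coprimality using (Coprime; coprime-Bézout)
open import Data.Nat.Divisibility using (_∣_; _∣?_; divides; >⇒∤; ∣m+n∣m⇒∣n; n∣m*n; ∣n⇒∣m*n; ∣-refl)
open import Data.Nat.DivMod using (_%_; _/_; m≡m%n+[m/n]*n; m%n<n)
open import Data.Nat.GCD using (module Bézout)
open import Data.Nat.Primality using (Prime; ¬prime[1]; prime⇒irreducible; euclidsLemma)
import Data.Nat.Tactic.RingSolver as ℕ-Solver
open import Data.Product using (Σ; ∃-syntax; _×_; _,_; proj₁; proj₂)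
open import Data.Rational as ℚ using (ℚ; 0ℚ; mkℚ; toℚᵘ)
import Data.Rational.Properties as ℚP
open import Data.Rational.Solver using (module +-*-Solver)
open import Data.Rational.Unnormalised as ℚᵘ using (mkℚᵘ; *<*) renaming (_≃_ to _≃ᵘ_; _<_ to _<ᵘ_)
import Data.Rational.Unnormalised.Properties as ℚᵘP
open import Data.Sum using (_⊎_; inj₁; inj₂) renaming (map to map-⊎)
open import Function using (_∘_)
open import Relation.Binary.PropositionalEquality
  using (_≡_; _≢_; refl; sym; trans; cong; cong₂; subst; subst₂; ≢-sym; module ≡-Reasoning)
open import Relation.Nullary using (¬_; Dec; does; yes; no)
open import Relation.Nullary.Decidable using (dec-true; dec-false)
open import Relation.Unary using (Decidable)

private variable A B : Set

∑ : List A → (A → ℤ) → ℤ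
∑ []       f = 0ℤ
∑ (x ∷ xs) f = f x + ∑ xs f

infixr 5 ∑
syntax ∑ xs (λ x → e) = ∑[ x ∈ xs ] e

∑-cong-∈ : ∀ (xs : List A) {f g : A → ℤ} → (∀ x → x ∈ xs → f x ≡ g x) → ∑ xs f ≡ ∑ xs g
∑-cong-∈ []       f≡g = refl
∑-cong-∈ (x ∷ xs) f≡g = cong₂ _+_ (f≡g x (here refl)) (∑-cong-∈ xs (λ y y∈ → f≡g y (there y∈)))

∑-cong : ∀ (xs : List A) {f g : A → ℤ} → (∀ x → f x ≡ g x) → ∑ xs f ≡ ∑ xs g
∑-cong xs f≡g = ∑-cong-∈ xs (λ x _ → f≡g x)

∑-mono-≤ : ∀ (xs : List A) {f g : A → ℤ} → (∀ x → x ∈ xs → f x ≤ g x) → ∑ xs f ≤ ∑ xs g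
∑-mono-≤ []       f≤g = ℤP.≤-refl
∑-mono-≤ (x ∷ xs) f≤g = ℤP.+-mono-≤ (f≤g x (here refl)) (∑-mono-≤ xs (λ y y∈ → f≤g y (there y∈)))

∑-nonNeg : ∀ (xs : List A) {f : A → ℤ} → (∀ x → 0ℤ ≤ f x) → 0ℤ ≤ ∑ xs f
∑-nonNeg []       0≤f = ℤP.≤-refl
∑-nonNeg (x ∷ xs) 0≤f = ℤP.+-mono-≤ (0≤f x) (∑-nonNeg xs 0≤f)

∑-++ : ∀ (xs ys : List A) (f : A → ℤ) → ∑ (xs ++ ys) f ≡ ∑ xs f + ∑ ys f
∑-++ []       ys f = sym (ℤP.+-identityˡ _)
∑-++ (x ∷ xs) ys f = trans (cong (_+_ (f x)) (∑-++ xs ys f)) (sym (ℤP.+-assoc (f x) _ _))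

∑-map : ∀ (g : A → B) xs (f : B → ℤ) → ∑ (map g xs) f ≡ ∑[ x ∈ xs ] f (g x)
∑-map g []       f = refl
∑-map g (x ∷ xs) f = cong (_+_ (f (g x))) (∑-map g xs f)

∑-concat : ∀ (xss : List (List A)) (f : A → ℤ) → ∑ (concat xss) f ≡ ∑[ xs ∈ xss ] ∑ xs f
∑-concat []         f = refl
∑-concat (xs ∷ xss) f = trans (∑-++ xs (concat xss) f) (cong (_+_ (∑ xs f)) (∑-concat xss f))

∑-concatMap : ∀ (g : A → List B) xs (f : B → ℤ) → ∑ (concatMap g xs) f ≡ ∑[ x ∈ xs ] ∑ (g x) f
∑-concatMap g xs f = trans (∑-concat (map g xs) f) (∑-map g xs (λ ys → ∑ ys f))

∑-distrib-+ : ∀ (xs : List A) (f g : A → ℤ) → ∑[ x ∈ xs ] (f x + g x) ≡ ∑ xs f + ∑ xs g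
∑-distrib-+ []       f g = refl
∑-distrib-+ (x ∷ xs) f g =
  trans (cong (_+_ (f x + g x)) (∑-distrib-+ xs f g)) (shuffle (f x) (g x) (∑ xs f) (∑ xs g))
  where shuffle : ∀ a b c d → a + b + (c + d) ≡ a + c + (b + d)
        shuffle = solve-∀

∑-*ˡ : ∀ (xs : List A) c (f : A → ℤ) → ∑[ x ∈ xs ] c * f x ≡ c * ∑ xs f
∑-*ˡ []       c f = sym (ℤP.*-zeroʳ c)
∑-*ˡ (x ∷ xs) c f = trans (cong (_+_ (c * f x)) (∑-*ˡ xs c f)) (sym (ℤP.*-distribˡ-+ c (f x) _))

∑-*ʳ : ∀ (xs : List A) c (f : A → ℤ) → ∑[ x ∈ xs ] f x * c ≡ ∑ xs f * c
∑-*ʳ xs c f = trans (∑-cong xs (λ x → ℤP.*-comm (f x) c)) (trans (∑-*ˡ xs c f) (ℤP.*-comm c _))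

∑-const : ∀ (xs : List A) c → ∑[ x ∈ xs ] c ≡ + length xs * c
∑-const []       c = refl
∑-const (x ∷ xs) c = trans (cong (_+_ c) (∑-const xs c)) (sym (ℤP.suc-* (+ length xs) c))

∑-zero : ∀ (xs : List A) → ∑[ x ∈ xs ] 0ℤ ≡ 0ℤ
∑-zero xs = trans (∑-const xs 0ℤ) (ℤP.*-zeroʳ (+ length xs))

∑-comm : ∀ (xs : List A) (ys : List B) (F : A → B → ℤ) →
  ∑[ x ∈ xs ] ∑[ y ∈ ys ] F x y ≡ ∑[ y ∈ ys ] ∑[ x ∈ xs ] F x y
∑-comm []       ys F = sym (∑-zero ys)
∑-comm (x ∷ xs) ys F =
  trans (cong (_+_ (∑ ys (F x))) (∑-comm xs ys F)) (sym (∑-distrib-+ ys (F x) _))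

∑-cartesianProduct : ∀ (xs : List A) (ys : List B) (F : A × B → ℤ) →
  ∑ (cartesianProduct xs ys) F ≡ ∑[ x ∈ xs ] ∑[ y ∈ ys ] F (x , y)
∑-cartesianProduct []       ys F = refl
∑-cartesianProduct (x ∷ xs) ys F =
  trans (∑-++ (map (x ,_) ys) _ F) (cong₂ _+_ (∑-map (x ,_) ys F) (∑-cartesianProduct xs ys F))

∑-*-∑ : ∀ (xs : List A) (ys : List B) (f : A → ℤ) (g : B → ℤ) →
        ∑ xs f * ∑ ys g ≡ ∑[ x ∈ xs ] ∑[ y ∈ ys ] f x * g y
∑-*-∑ xs ys f g = trans (sym (∑-*ʳ xs (∑ ys g) f)) (∑-cong xs (λ x → sym (∑-*ˡ ys (f x) g)))

∑-quartic : ∀ (xs : List A) (f : A → ℤ) a₀ a₁ a₂ a₃ a₄ →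
  ∑[ x ∈ xs ] (a₀ + a₁ * f x + a₂ * (f x * f x) + a₃ * (f x * f x * f x) + a₄ * (f x * f x * f x * f x))
  ≡ a₀ * + length xs + a₁ * ∑ xs f + a₂ * (∑[ x ∈ xs ] f x * f x)
    + a₃ * (∑[ x ∈ xs ] f x * f x * f x) + a₄ * (∑[ x ∈ xs ] f x * f x * f x * f x)
∑-quartic []       f a₀ a₁ a₂ a₃ a₄ = sym (vanish a₀ a₁ a₂ a₃ a₄)
  where vanish : ∀ a₀ a₁ a₂ a₃ a₄ → a₀ * 0ℤ + a₁ * 0ℤ + a₂ * 0ℤ + a₃ * 0ℤ + a₄ * 0ℤ ≡ 0ℤ
        vanish = solve-∀
∑-quartic (x ∷ xs) f a₀ a₁ a₂ a₃ a₄ = trans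
  (cong (_+_ (a₀ + a₁ * f x + a₂ * (f x * f x) + a₃ * (f x * f x * f x) + a₄ * (f x * f x * f x * f x)))
        (∑-quartic xs f a₀ a₁ a₂ a₃ a₄))
  (step a₀ a₁ a₂ a₃ a₄ (f x) (+ length xs) _ _ _ _)
  where step : ∀ a₀ a₁ a₂ a₃ a₄ y l s₁ s₂ s₃ s₄ →
                 a₀ + a₁ * y + a₂ * (y * y) + a₃ * (y * y * y) + a₄ * (y * y * y * y)
                 + (a₀ * l + a₁ * s₁ + a₂ * s₂ + a₃ * s₃ + a₄ * s₄)
               ≡ a₀ * (+ 1 + l) + a₁ * (y + s₁) + a₂ * (y * y + s₂) + a₃ * (y * y * y + s₃)
                 + a₄ * (y * y * y * y + s₄)
        step = solve-∀

∑-neg : ∀ (xs : List A) (f : A → ℤ) → ∑[ x ∈ xs ] - f x ≡ - ∑ xs f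
∑-neg []       f = refl
∑-neg (x ∷ xs) f = trans (cong (_+_ (- f x)) (∑-neg xs f)) (sym (ℤP.neg-distrib-+ (f x) (∑ xs f)))

𝟙 : ∀ {P : Set} → Dec P → ℤ
𝟙 P? = if does P? then 1ℤ else 0ℤ

𝟙-yes : ∀ {P : Set} (P? : Dec P) → P → 𝟙 P? ≡ 1ℤ
𝟙-yes P? p = cong (if_then 1ℤ else 0ℤ) (dec-true P? p)

𝟙-no : ∀ {P : Set} (P? : Dec P) → ¬ P → 𝟙 P? ≡ 0ℤ
𝟙-no P? ¬p = cong (if_then 1ℤ else 0ℤ) (dec-false P? ¬p)

∑-upTo-suc : ∀ m (f : ℕ → ℤ) → ∑ (upTo (suc m)) f ≡ ∑ (upTo m) f + f m
∑-upTo-suc m f = begin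
    ∑ (upTo (suc m)) f
  ≡⟨ cong (λ ks → ∑ ks f) (sym (upTo-∷ʳ m)) ⟩
    ∑ (upTo m ∷ʳ m) f
  ≡⟨ ∑-++ (upTo m) [ m ] f ⟩
    ∑ (upTo m) f + (f m + 0ℤ)
  ≡⟨ cong (_+_ (∑ (upTo m) f)) (ℤP.+-identityʳ (f m)) ⟩
    ∑ (upTo m) f + f m
  ∎
  where open ≡-Reasoning

∑-upTo-zero : ∀ m (f : ℕ → ℤ) → (∀ k → k ℕ.< m → f k ≡ 0ℤ) → ∑ (upTo m) f ≡ 0ℤ
∑-upTo-zero m f f≡0 = trans (∑-cong-∈ (upTo m) (λ k k∈ → f≡0 k (∈-upTo⁻ k∈))) (∑-zero (upTo m))

∑-upTo-δ : ∀ m {a} (f : ℕ → ℤ) → a ℕ.< m → (∀ k → k ℕ.< m → k ≢ a → f k ≡ 0ℤ) →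
           ∑ (upTo m) f ≡ f a
∑-upTo-δ (suc m) {a} f a<1+m f≡0 with a ℕ.≟ m
... | yes refl = begin
    ∑ (upTo (suc a)) f
  ≡⟨ ∑-upTo-suc a f ⟩
    ∑ (upTo a) f + f a
  ≡⟨ cong (_+ f a) (∑-upTo-zero a f (λ k k<a → f≡0 k (ℕP.m<n⇒m<1+n k<a) (ℕP.<⇒≢ k<a))) ⟩
    0ℤ + f a
  ≡⟨ ℤP.+-identityˡ (f a) ⟩
    f a
  ∎
  where open ≡-Reasoning
... | no a≢m = begin
    ∑ (upTo (suc m)) f
  ≡⟨ ∑-upTo-suc m f ⟩
    ∑ (upTo m) f + f m
  ≡⟨ cong₂ _+_ (∑-upTo-δ m f a<m (λ k k<m → f≡0 k (ℕP.m<n⇒m<1+n k<m))) (f≡0 m ℕP.≤-refl (≢-sym a≢m)) ⟩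
    f a + 0ℤ
  ≡⟨ ℤP.+-identityʳ (f a) ⟩
    f a
  ∎
  where
    open ≡-Reasoning
    a<m : a ℕ.< m
    a<m = ℕP.≤∧≢⇒< (ℕP.≤-pred a<1+m) a≢m

0≤i*j : ∀ {i j} → 0ℤ ≤ i → 0ℤ ≤ j → 0ℤ ≤ i * j
0≤i*j {+ m} {+ n} _ _ = subst (0ℤ ≤_) (ℤP.pos-* m n) (+≤+ z≤n)

0<i*j : ∀ {i j} → 0ℤ < i → 0ℤ < j → 0ℤ < i * j
0<i*j {i} {j} 0<i 0<j = subst (_< i * j) (ℤP.*-zeroˡ j) (ℤP.*-monoʳ-<-pos j {{ℤ.positive 0<j}} 0<i)

0≤i*i : ∀ i → 0ℤ ≤ i * i
0≤i*i (+ m)    = 0≤i*j {+ m} {+ m} (+≤+ z≤n) (+≤+ z≤n)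
0≤i*i -[1+ m ] = +≤+ z≤n

*-mono-≤-nonNeg : ∀ {i j k l} → 0ℤ ≤ i → 0ℤ ≤ l → i ≤ j → k ≤ l → i * k ≤ j * l
*-mono-≤-nonNeg {i} {j} {k} {l} 0≤i 0≤l i≤j k≤l = ℤP.≤-trans
  (ℤP.*-monoˡ-≤-nonNeg i {{ℤ.nonNegative 0≤i}} k≤l) (ℤP.*-monoʳ-≤-nonNeg l {{ℤ.nonNegative 0≤l}} i≤j)

≤-by-gap : ∀ {i j} d → 0ℤ ≤ d → j ≡ i + d → i ≤ j
≤-by-gap {i} d 0≤d refl = subst (_≤ i + d) (ℤP.+-identityʳ i) (ℤP.+-monoʳ-≤ i 0≤d)

<-by-gap : ∀ {i j} d → 0ℤ < d → j ≡ i + d → i < j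
<-by-gap {i} d 0<d refl = subst (_< i + d) (ℤP.+-identityʳ i) (ℤP.+-monoʳ-< i 0<d)

i*i≤j*j : ∀ {i j} → - j ≤ i → i ≤ j → i * i ≤ j * j
i*i≤j*j {i} {j} -j≤i i≤j = ≤-by-gap ((j - i) * (j + i))
  (0≤i*j (ℤP.i≤j⇒0≤j-i i≤j) (subst (0ℤ ≤_) (neg-neg i j) (ℤP.i≤j⇒0≤j-i -j≤i))) (split i j)
  where neg-neg : ∀ i j → i - (- j) ≡ j + i
        neg-neg = solve-∀
        split : ∀ i j → j * j ≡ i * i + (j - i) * (j + i)
        split = solve-∀

[i+j+k]²≤3[i²+j²+k²] : ∀ i j k → (i + j + k) * (i + j + k) ≤ + 3 * (i * i + j * j + k * k)
[i+j+k]²≤3[i²+j²+k²] i j k = ≤-by-gap ((i - j) * (i - j) + (j - k) * (j - k) + (i - k) * (i - k))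
  (ℤP.+-mono-≤ (ℤP.+-mono-≤ (0≤i*i (i - j)) (0≤i*i (j - k))) (0≤i*i (i - k))) (split i j k)
  where split : ∀ i j k → + 3 * (i * i + j * j + k * k)
                        ≡ (i + j + k) * (i + j + k) + ((i - j) * (i - j) + (j - k) * (j - k) + (i - k) * (i - k))
        split = solve-∀

*-monoʳ-<-pos′ : ∀ {i j} c → 0ℤ < c → i < j → i * c < j * c
*-monoʳ-<-pos′ c 0<c = ℤP.*-monoʳ-<-pos c {{ℤ.positive 0<c}}

i≤i*i : ∀ {i} → 1ℤ ≤ i → i ≤ i * i
i≤i*i {i} 1≤i = ≤-by-gap (i * (i - 1ℤ)) (0≤i*j (ℤP.≤-trans (+≤+ z≤n) 1≤i) (ℤP.i≤j⇒0≤j-i 1≤i)) (split i)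
  where split : ∀ i → i * i ≡ i + i * (i - 1ℤ)
        split = solve-∀

<-shift : ∀ {x y z} → x + y < z → y < z - x
<-shift {x} {y} {z} x+y<z = subst (_< z - x) (cancel x y) (ℤP.+-monoˡ-< (- x) x+y<z)
  where cancel : ∀ x y → x + y - x ≡ y
        cancel = solve-∀

i≤∣j∣⇒i*i≤j*j : ∀ {i j} → 0ℤ ≤ i → i ≤ j ⊎ i ≤ - j → i * i ≤ j * j
i≤∣j∣⇒i*i≤j*j 0≤i (inj₁ i≤j)  = *-mono-≤-nonNeg 0≤i (ℤP.≤-trans 0≤i i≤j) i≤j i≤j
i≤∣j∣⇒i*i≤j*j {i} {j} 0≤i (inj₂ i≤-j) =
  subst (i * i ≤_) (neg-square j) (*-mono-≤-nonNeg 0≤i (ℤP.≤-trans 0≤i i≤-j) i≤-j i≤-j)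
  where neg-square : ∀ j → - j * - j ≡ j * j
        neg-square = solve-∀

-- Sums of independent centred variables

module _ (xs : List A) (ys : List B) (u : A → ℤ) (v : B → ℤ) where

  private
    m n : ℤ
    m = + length xs
    n = + length ys
    U₁ U₂ U₃ U₄ V₁ V₂ V₃ V₄ : ℤ
    U₁ = ∑ xs u
    U₂ = ∑[ x ∈ xs ] u x * u x
    U₃ = ∑[ x ∈ xs ] u x * u x * u x
    U₄ = ∑[ x ∈ xs ] u x * u x * u x * u x
    V₁ = ∑ ys v
    V₂ = ∑[ y ∈ ys ] v y * v y
    V₃ = ∑[ y ∈ ys ] v y * v y * v y
    V₄ = ∑[ y ∈ ys ] v y * v y * v y * v y

  ∑∑-+ : ∑[ x ∈ xs ] ∑[ y ∈ ys ] u x + v y ≡ U₁ * n + m * V₁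
  ∑∑-+ = begin
      ∑[ x ∈ xs ] ∑[ y ∈ ys ] u x + v y
    ≡⟨ ∑-cong xs (λ x → ∑-distrib-+ ys (λ _ → u x) v) ⟩
      ∑[ x ∈ xs ] (∑[ y ∈ ys ] u x) + V₁
    ≡⟨ ∑-distrib-+ xs (λ x → ∑[ y ∈ ys ] u x) (λ _ → V₁) ⟩
      (∑[ x ∈ xs ] ∑[ y ∈ ys ] u x) + (∑[ x ∈ xs ] V₁)
    ≡⟨ cong₂ _+_ (trans (∑-cong xs (λ x → trans (∑-const ys (u x)) (ℤP.*-comm n (u x)))) (∑-*ʳ xs n u))
                 (∑-const xs V₁) ⟩
      U₁ * n + m * V₁
    ∎
    where open ≡-Reasoning

  ∑∑-+² : ∑[ x ∈ xs ] ∑[ y ∈ ys ] (u x + v y) * (u x + v y) ≡ U₂ * n + + 2 * U₁ * V₁ + m * V₂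
  ∑∑-+² = begin
      ∑[ x ∈ xs ] ∑[ y ∈ ys ] (u x + v y) * (u x + v y)
    ≡⟨ ∑-cong xs (λ x → trans (∑-cong ys (λ y → expand (u x) (v y)))
                              (∑-quartic ys v (u x * u x) (+ 2 * u x) 1ℤ 0ℤ 0ℤ)) ⟩
      ∑[ x ∈ xs ] (u x * u x * n + + 2 * u x * V₁ + 1ℤ * V₂ + 0ℤ * V₃ + 0ℤ * V₄)
    ≡⟨ ∑-cong xs (λ x → regroup (u x) n V₁ V₂ V₃ V₄) ⟩
      ∑[ x ∈ xs ] (V₂ + + 2 * V₁ * u x + n * (u x * u x) + 0ℤ * (u x * u x * u x)
                   + 0ℤ * (u x * u x * u x * u x))
    ≡⟨ ∑-quartic xs u V₂ (+ 2 * V₁) n 0ℤ 0ℤ ⟩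
      V₂ * m + + 2 * V₁ * U₁ + n * U₂ + 0ℤ * U₃ + 0ℤ * U₄
    ≡⟨ collect V₁ V₂ m n U₁ U₂ U₃ U₄ ⟩
      U₂ * n + + 2 * U₁ * V₁ + m * V₂
    ∎
    where
      open ≡-Reasoning
      expand : ∀ a b → (a + b) * (a + b)
             ≡ a * a + + 2 * a * b + 1ℤ * (b * b) + 0ℤ * (b * b * b) + 0ℤ * (b * b * b * b)
      expand = solve-∀
      regroup : ∀ a n s₁ s₂ s₃ s₄ → a * a * n + + 2 * a * s₁ + 1ℤ * s₂ + 0ℤ * s₃ + 0ℤ * s₄
              ≡ s₂ + + 2 * s₁ * a + n * (a * a) + 0ℤ * (a * a * a) + 0ℤ * (a * a * a * a)
      regroup = solve-∀
      collect : ∀ s₁ s₂ m n t₁ t₂ t₃ t₄ → s₂ * m + + 2 * s₁ * t₁ + n * t₂ + 0ℤ * t₃ + 0ℤ * t₄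
              ≡ t₂ * n + + 2 * t₁ * s₁ + m * s₂
      collect = solve-∀

  ∑∑-+⁴ : ∑[ x ∈ xs ] ∑[ y ∈ ys ] (u x + v y) * (u x + v y) * (u x + v y) * (u x + v y)
        ≡ U₄ * n + + 4 * U₃ * V₁ + + 6 * U₂ * V₂ + + 4 * U₁ * V₃ + m * V₄
  ∑∑-+⁴ = begin
      ∑[ x ∈ xs ] ∑[ y ∈ ys ] (u x + v y) * (u x + v y) * (u x + v y) * (u x + v y)
    ≡⟨ ∑-cong xs (λ x → trans (∑-cong ys (λ y → expand (u x) (v y)))
          (∑-quartic ys v (u x * u x * u x * u x) (+ 4 * u x * u x * u x) (+ 6 * u x * u x) (+ 4 * u x) 1ℤ)) ⟩
      ∑[ x ∈ xs ] (u x * u x * u x * u x * n + + 4 * u x * u x * u x * V₁ + + 6 * u x * u x * V₂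
                   + + 4 * u x * V₃ + 1ℤ * V₄)
    ≡⟨ ∑-cong xs (λ x → regroup (u x) n V₁ V₂ V₃ V₄) ⟩
      ∑[ x ∈ xs ] (V₄ + + 4 * V₃ * u x + + 6 * V₂ * (u x * u x) + + 4 * V₁ * (u x * u x * u x)
                   + n * (u x * u x * u x * u x))
    ≡⟨ ∑-quartic xs u V₄ (+ 4 * V₃) (+ 6 * V₂) (+ 4 * V₁) n ⟩
      V₄ * m + + 4 * V₃ * U₁ + + 6 * V₂ * U₂ + + 4 * V₁ * U₃ + n * U₄
    ≡⟨ collect V₁ V₂ V₃ V₄ m n U₁ U₂ U₃ U₄ ⟩
      U₄ * n + + 4 * U₃ * V₁ + + 6 * U₂ * V₂ + + 4 * U₁ * V₃ + m * V₄
    ∎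
    where
      open ≡-Reasoning
      expand : ∀ a b → (a + b) * (a + b) * (a + b) * (a + b)
             ≡ a * a * a * a + + 4 * a * a * a * b + + 6 * a * a * (b * b) + + 4 * a * (b * b * b)
               + 1ℤ * (b * b * b * b)
      expand = solve-∀
      regroup : ∀ a n s₁ s₂ s₃ s₄ →
                a * a * a * a * n + + 4 * a * a * a * s₁ + + 6 * a * a * s₂ + + 4 * a * s₃ + 1ℤ * s₄
              ≡ s₄ + + 4 * s₃ * a + + 6 * s₂ * (a * a) + + 4 * s₁ * (a * a * a) + n * (a * a * a * a)
      regroup = solve-∀
      collect : ∀ s₁ s₂ s₃ s₄ m n t₁ t₂ t₃ t₄ →
                s₄ * m + + 4 * s₃ * t₁ + + 6 * s₂ * t₂ + + 4 * s₁ * t₃ + n * t₄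
              ≡ t₄ * n + + 4 * t₃ * s₁ + + 6 * t₂ * s₂ + + 4 * t₁ * s₃ + m * s₄
      collect = solve-∀

tuplesOf : List A → ℕ → List (List A)
tuplesOf L zero    = [] ∷ []
tuplesOf L (suc n) = concatMap (λ l → map (l ∷_) (tuplesOf L n)) L

∑-tuplesOf-suc : ∀ (L : List A) n (F : List A → ℤ) →
  ∑ (tuplesOf L (suc n)) F ≡ ∑[ l ∈ L ] ∑[ x ∈ tuplesOf L n ] F (l ∷ x)
∑-tuplesOf-suc L n F = trans (∑-concatMap _ L F) (∑-cong L (λ l → ∑-map (l ∷_) (tuplesOf L n) F))

length≡∑1 : ∀ (xs : List A) → + length xs ≡ ∑[ x ∈ xs ] 1ℤ
length≡∑1 xs = sym (trans (∑-const xs 1ℤ) (ℤP.*-identityʳ _))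

length-tuplesOf-suc : ∀ (L : List A) n →
  + length (tuplesOf L (suc n)) ≡ + length L * + length (tuplesOf L n)
length-tuplesOf-suc L n = begin
    + length (tuplesOf L (suc n))
  ≡⟨ length≡∑1 (tuplesOf L (suc n)) ⟩
    ∑ (tuplesOf L (suc n)) (λ _ → 1ℤ)
  ≡⟨ ∑-tuplesOf-suc L n (λ _ → 1ℤ) ⟩
    ∑[ l ∈ L ] ∑[ x ∈ tuplesOf L n ] 1ℤ
  ≡⟨ ∑-cong L (λ _ → sym (length≡∑1 (tuplesOf L n))) ⟩
    ∑[ l ∈ L ] + length (tuplesOf L n)
  ≡⟨ ∑-const L _ ⟩
    + length L * + length (tuplesOf L n)
  ∎
  where open ≡-Reasoning

0<length-tuplesOf : ∀ (L : List A) n → 0ℤ < + length L → 0ℤ < + length (tuplesOf L n)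
0<length-tuplesOf L zero    _    = +<+ (s≤s z≤n)
0<length-tuplesOf L (suc n) 0<∣L∣ =
  subst (0ℤ <_) (sym (length-tuplesOf-suc L n)) (0<i*j 0<∣L∣ (0<length-tuplesOf L n 0<∣L∣))

module MomentsOfSums (L : List A) (g : A → ℤ) (∑g≡0 : ∑ L g ≡ 0ℤ)
                     (B : ℤ) (0≤B : 0ℤ ≤ B) (g²≤B : ∀ l → l ∈ L → g l * g l ≤ B) where

  private
    m : ℤ
    m = + length L

    count : ℕ → ℤ
    count n = + length (tuplesOf L n)

    S : List A → ℤ
    S x = ∑ x g

    G₂ G₃ G₄ : ℤ
    G₂ = ∑[ l ∈ L ] g l * g l
    G₃ = ∑[ l ∈ L ] g l * g l * g l
    G₄ = ∑[ l ∈ L ] g l * g l * g l * g l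

    M₂ M₃ M₄ : ℕ → ℤ
    M₂ n = ∑[ x ∈ tuplesOf L n ] S x * S x
    M₃ n = ∑[ x ∈ tuplesOf L n ] S x * S x * S x
    M₄ n = ∑[ x ∈ tuplesOf L n ] S x * S x * S x * S x

    0≤G₂ : 0ℤ ≤ G₂
    0≤G₂ = ∑-nonNeg L (λ l → 0≤i*i (g l))

    G₂≤ : G₂ ≤ m * B
    G₂≤ = ℤP.≤-trans (∑-mono-≤ L g²≤B) (ℤP.≤-reflexive (∑-const L B))

    G₄≤ : G₄ ≤ m * (B * B)
    G₄≤ = ℤP.≤-trans (∑-mono-≤ L g⁴≤) (ℤP.≤-reflexive (∑-const L (B * B)))
      where g⁴≤ : ∀ l → l ∈ L → g l * g l * g l * g l ≤ B * B
            g⁴≤ l l∈ = subst (_≤ B * B) (sym (ℤP.*-assoc (g l * g l) (g l) (g l)))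
                         (*-mono-≤-nonNeg (0≤i*i (g l)) 0≤B (g²≤B l l∈) (g²≤B l l∈))

  moment₁≡0 : ∀ n → ∑[ x ∈ tuplesOf L n ] S x ≡ 0ℤ
  moment₁≡0 zero    = refl
  moment₁≡0 (suc n) = begin
      ∑ (tuplesOf L (suc n)) S
    ≡⟨ ∑-tuplesOf-suc L n S ⟩
      ∑[ l ∈ L ] ∑[ x ∈ tuplesOf L n ] g l + S x
    ≡⟨ ∑∑-+ L (tuplesOf L n) g S ⟩
      ∑ L g * count n + m * ∑ (tuplesOf L n) S
    ≡⟨ cong₂ (λ a b → a * count n + m * b) ∑g≡0 (moment₁≡0 n) ⟩
      0ℤ * count n + m * 0ℤ
    ≡⟨ cong₂ _+_ (ℤP.*-zeroˡ (count n)) (ℤP.*-zeroʳ m) ⟩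
      0ℤ
    ∎
    where open ≡-Reasoning

  moment₂-suc : ∀ n → M₂ (suc n) ≡ G₂ * count n + m * M₂ n
  moment₂-suc n = begin
      M₂ (suc n)
    ≡⟨ ∑-tuplesOf-suc L n (λ x → S x * S x) ⟩
      ∑[ l ∈ L ] ∑[ x ∈ tuplesOf L n ] (g l + S x) * (g l + S x)
    ≡⟨ ∑∑-+² L (tuplesOf L n) g S ⟩
      G₂ * count n + + 2 * ∑ L g * ∑ (tuplesOf L n) S + m * M₂ n
    ≡⟨ cong₂ (λ a b → G₂ * count n + + 2 * a * b + m * M₂ n) ∑g≡0 (moment₁≡0 n) ⟩
      G₂ * count n + + 2 * 0ℤ * 0ℤ + m * M₂ n
    ≡⟨ drop-odd (G₂ * count n) (m * M₂ n) ⟩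
      G₂ * count n + m * M₂ n
    ∎
    where
      open ≡-Reasoning
      drop-odd : ∀ a b → a + + 2 * 0ℤ * 0ℤ + b ≡ a + b
      drop-odd = solve-∀

  moment₄-suc : ∀ n → M₄ (suc n) ≡ G₄ * count n + + 6 * G₂ * M₂ n + m * M₄ n
  moment₄-suc n = begin
      M₄ (suc n)
    ≡⟨ ∑-tuplesOf-suc L n (λ x → S x * S x * S x * S x) ⟩
      ∑[ l ∈ L ] ∑[ x ∈ tuplesOf L n ] (g l + S x) * (g l + S x) * (g l + S x) * (g l + S x)
    ≡⟨ ∑∑-+⁴ L (tuplesOf L n) g S ⟩
      G₄ * count n + + 4 * G₃ * ∑ (tuplesOf L n) S + + 6 * G₂ * M₂ n + + 4 * ∑ L g * M₃ n + m * M₄ n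
    ≡⟨ cong₂ (λ a b → G₄ * count n + + 4 * G₃ * a + + 6 * G₂ * M₂ n + + 4 * b * M₃ n + m * M₄ n)
             (moment₁≡0 n) ∑g≡0 ⟩
      G₄ * count n + + 4 * G₃ * 0ℤ + + 6 * G₂ * M₂ n + + 4 * 0ℤ * M₃ n + m * M₄ n
    ≡⟨ drop-odd (G₄ * count n) G₃ (+ 6 * G₂ * M₂ n) (M₃ n) (m * M₄ n) ⟩
      G₄ * count n + + 6 * G₂ * M₂ n + m * M₄ n
    ∎
    where
      open ≡-Reasoning
      drop-odd : ∀ a b c d e → a + + 4 * b * 0ℤ + c + + 4 * 0ℤ * d + e ≡ a + c + e
      drop-odd = solve-∀

  moment₂≤ : ∀ n → M₂ n ≤ + n * B * count n
  moment₂≤ zero    = +≤+ z≤n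
  moment₂≤ (suc n) = begin
      M₂ (suc n)
    ≡⟨ moment₂-suc n ⟩
      G₂ * count n + m * M₂ n
    ≤⟨ ℤP.+-mono-≤ (ℤP.*-monoʳ-≤-nonNeg (count n) G₂≤) (ℤP.*-monoˡ-≤-nonNeg m (moment₂≤ n)) ⟩
      m * B * count n + m * (+ n * B * count n)
    ≡⟨ collect m B (count n) (+ n) ⟩
      (+ 1 + + n) * B * (m * count n)
    ≡⟨ cong ((+ 1 + + n) * B *_) (sym (length-tuplesOf-suc L n)) ⟩
      + suc n * B * count (suc n)
    ∎
    where
      open ℤP.≤-Reasoning
      collect : ∀ m B c n → m * B * c + m * (n * B * c) ≡ (+ 1 + n) * B * (m * c)
      collect = solve-∀

  moment₄≤ : ∀ n → M₄ n ≤ + 3 * + n * + n * (B * B) * count n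
  moment₄≤ zero    = +≤+ z≤n
  moment₄≤ (suc n) = begin
      M₄ (suc n)
    ≡⟨ moment₄-suc n ⟩
      G₄ * count n + + 6 * G₂ * M₂ n + m * M₄ n
    ≤⟨ ℤP.+-mono-≤ (ℤP.+-mono-≤ (ℤP.*-monoʳ-≤-nonNeg (count n) G₄≤)
                                (*-mono-≤-nonNeg 0≤6G₂ 0≤nBc (ℤP.*-monoˡ-≤-nonNeg (+ 6) G₂≤) (moment₂≤ n)))
                   (ℤP.*-monoˡ-≤-nonNeg m (moment₄≤ n)) ⟩
      m * (B * B) * count n + + 6 * (m * B) * (+ n * B * count n) + m * (+ 3 * + n * + n * (B * B) * count n)
    ≡⟨ collect m B (count n) (+ n) ⟩
      (+ 1 + + 6 * + n + + 3 * + n * + n) * (B * B * (m * count n))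
    ≤⟨ ℤP.*-monoʳ-≤-nonNeg (B * B * (m * count n)) {{ℤ.nonNegative 0≤B²mc}}
         (≤-by-gap {+ 1 + + 6 * + n + + 3 * + n * + n} (+ 2) (+≤+ z≤n) (square-succ (+ n))) ⟩
      + 3 * (+ 1 + + n) * (+ 1 + + n) * (B * B * (m * count n))
    ≡⟨ cong (λ c → + 3 * (+ 1 + + n) * (+ 1 + + n) * (B * B * c)) (sym (length-tuplesOf-suc L n)) ⟩
      + 3 * (+ 1 + + n) * (+ 1 + + n) * (B * B * count (suc n))
    ≡⟨ reassoc (+ 1 + + n) B (count (suc n)) ⟩
      + 3 * + suc n * + suc n * (B * B) * count (suc n)
    ∎
    where
      open ℤP.≤-Reasoning
      0≤6G₂ : 0ℤ ≤ + 6 * G₂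
      0≤6G₂ = 0≤i*j {+ 6} (+≤+ z≤n) 0≤G₂
      0≤nBc : 0ℤ ≤ + n * B * count n
      0≤nBc = ℤP.≤-trans (∑-nonNeg (tuplesOf L n) (λ x → 0≤i*i (S x))) (moment₂≤ n)
      0≤B²mc : 0ℤ ≤ B * B * (m * count n)
      0≤B²mc = 0≤i*j (0≤i*i B) (0≤i*j {m} (+≤+ z≤n) (+≤+ z≤n))
      collect : ∀ m B c n → m * (B * B) * c + + 6 * (m * B) * (n * B * c) + m * (+ 3 * n * n * (B * B) * c)
              ≡ (+ 1 + + 6 * n + + 3 * n * n) * (B * B * (m * c))
      collect = solve-∀
      square-succ : ∀ n → + 3 * (+ 1 + n) * (+ 1 + n) ≡ (+ 1 + + 6 * n + + 3 * n * n) + + 2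
      square-succ = solve-∀
      reassoc : ∀ k B c → + 3 * k * k * (B * B * c) ≡ + 3 * k * k * (B * B) * c
      reassoc = solve-∀

∈-tuplesOf⁻ : ∀ {L : List A} {n z} → z ∈ tuplesOf L n → length z ≡ n
∈-tuplesOf⁻ {n = zero}  (here refl) = refl
∈-tuplesOf⁻ {L = L} {n = suc n} z∈ with satisfied (∈-concatMap⁻ (λ l → map (l ∷_) (tuplesOf L n)) {xs = L} z∈)
... | l , z∈′ with ∈-map⁻ (l ∷_) z∈′
...   | t , t∈ , refl = cong suc (∈-tuplesOf⁻ {L = L} t∈)

∑-tuplesOf-pairs : ∀ (R : List A) (S : List B) n (F : List A → List B → ℤ) →
  ∑[ t ∈ tuplesOf R n ] ∑[ u ∈ tuplesOf S n ] F t u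
  ≡ ∑[ z ∈ tuplesOf (cartesianProduct R S) n ] F (map proj₁ z) (map proj₂ z)
∑-tuplesOf-pairs R S zero    F = ℤP.+-identityʳ _
∑-tuplesOf-pairs R S (suc n) F = begin
    ∑[ t ∈ tuplesOf R (suc n) ] ∑[ u ∈ tuplesOf S (suc n) ] F t u
  ≡⟨ ∑-tuplesOf-suc R n _ ⟩
    ∑[ a ∈ R ] ∑[ t ∈ tuplesOf R n ] ∑[ u ∈ tuplesOf S (suc n) ] F (a ∷ t) u
  ≡⟨ ∑-cong R (λ a → ∑-cong (tuplesOf R n) (λ t → ∑-tuplesOf-suc S n _)) ⟩
    ∑[ a ∈ R ] ∑[ t ∈ tuplesOf R n ] ∑[ b ∈ S ] ∑[ u ∈ tuplesOf S n ] F (a ∷ t) (b ∷ u)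
  ≡⟨ ∑-cong R (λ a → ∑-comm (tuplesOf R n) S _) ⟩
    ∑[ a ∈ R ] ∑[ b ∈ S ] ∑[ t ∈ tuplesOf R n ] ∑[ u ∈ tuplesOf S n ] F (a ∷ t) (b ∷ u)
  ≡⟨ ∑-cong R (λ a → ∑-cong S (λ b → ∑-tuplesOf-pairs R S n (λ t u → F (a ∷ t) (b ∷ u)))) ⟩
    ∑[ a ∈ R ] ∑[ b ∈ S ] ∑[ z ∈ tuplesOf (cartesianProduct R S) n ] F (a ∷ map proj₁ z) (b ∷ map proj₂ z)
  ≡⟨ sym (∑-cartesianProduct R S _) ⟩
    ∑[ ab ∈ cartesianProduct R S ] ∑[ z ∈ tuplesOf (cartesianProduct R S) n ]
      F (map proj₁ (ab ∷ z)) (map proj₂ (ab ∷ z))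
  ≡⟨ sym (∑-tuplesOf-suc (cartesianProduct R S) n _) ⟩
    ∑[ z ∈ tuplesOf (cartesianProduct R S) (suc n) ] F (map proj₁ z) (map proj₂ z)
  ∎
  where open ≡-Reasoning

-- The coefficient range [-N, N]

∑-upTo-id : ∀ m → + 2 * (∑[ k ∈ upTo m ] + k) ≡ + m * (+ m - 1ℤ)
∑-upTo-id zero    = refl
∑-upTo-id (suc m) = begin
    + 2 * (∑[ k ∈ upTo (suc m) ] + k)
  ≡⟨ cong (+ 2 *_) (∑-upTo-suc m (λ k → + k)) ⟩
    + 2 * ((∑[ k ∈ upTo m ] + k) + + m)
  ≡⟨ ℤP.*-distribˡ-+ (+ 2) (∑[ k ∈ upTo m ] + k) (+ m) ⟩
    + 2 * (∑[ k ∈ upTo m ] + k) + + 2 * + m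
  ≡⟨ cong (_+ + 2 * + m) (∑-upTo-id m) ⟩
    + m * (+ m - 1ℤ) + + 2 * + m
  ≡⟨ step (+ m) ⟩
    + suc m * (+ suc m - 1ℤ)
  ∎
  where
    open ≡-Reasoning
    step : ∀ m → m * (m - 1ℤ) + + 2 * m ≡ (1ℤ + m) * (1ℤ + m - 1ℤ)
    step = solve-∀

∑-upTo-square : ∀ m → + 6 * (∑[ k ∈ upTo m ] + k * + k) ≡ (+ m - 1ℤ) * + m * (+ 2 * + m - 1ℤ)
∑-upTo-square zero    = refl
∑-upTo-square (suc m) = begin
    + 6 * (∑[ k ∈ upTo (suc m) ] + k * + k)
  ≡⟨ cong (+ 6 *_) (∑-upTo-suc m (λ k → + k * + k)) ⟩
    + 6 * ((∑[ k ∈ upTo m ] + k * + k) + + m * + m)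
  ≡⟨ ℤP.*-distribˡ-+ (+ 6) (∑[ k ∈ upTo m ] + k * + k) (+ m * + m) ⟩
    + 6 * (∑[ k ∈ upTo m ] + k * + k) + + 6 * (+ m * + m)
  ≡⟨ cong (_+ + 6 * (+ m * + m)) (∑-upTo-square m) ⟩
    (+ m - 1ℤ) * + m * (+ 2 * + m - 1ℤ) + + 6 * (+ m * + m)
  ≡⟨ step (+ m) ⟩
    (+ suc m - 1ℤ) * + suc m * (+ 2 * + suc m - 1ℤ)
  ∎
  where
    open ≡-Reasoning
    step : ∀ m → (m - 1ℤ) * m * (+ 2 * m - 1ℤ) + + 6 * (m * m)
             ≡ (1ℤ + m - 1ℤ) * (1ℤ + m) * (+ 2 * (1ℤ + m) - 1ℤ)
    step = solve-∀

module CoefficientRange (N : ℕ) where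

  size : ℕ
  size = suc (2 ℕ.* N)

  M : ℤ
  M = + 1 + + 2 * + N

  +size≡M : + size ≡ M
  +size≡M = cong (_+_ 1ℤ) (ℤP.pos-* 2 N)

  length-range : + length (range N) ≡ M
  length-range = trans (cong +_ (trans (length-map _ (upTo size)) (length-upTo size))) +size≡M

  ∑-range-id : ∑[ a ∈ range N ] a ≡ 0ℤ
  ∑-range-id = ℤP.*-cancelˡ-≡ (+ 2) _ _ (begin
      + 2 * (∑[ a ∈ range N ] a)
    ≡⟨ cong (+ 2 *_) (trans (∑-map (λ k → + k - + N) (upTo size) (λ a → a))
                            (∑-distrib-+ (upTo size) (λ k → + k) (λ _ → - + N))) ⟩
      + 2 * ((∑[ k ∈ upTo size ] + k) + (∑[ k ∈ upTo size ] - + N))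
    ≡⟨ ℤP.*-distribˡ-+ (+ 2) (∑[ k ∈ upTo size ] + k) _ ⟩
      + 2 * (∑[ k ∈ upTo size ] + k) + + 2 * (∑[ k ∈ upTo size ] - + N)
    ≡⟨ cong₂ (λ s t → s + + 2 * t) (∑-upTo-id size)
             (trans (∑-const (upTo size) (- + N)) (cong (λ l → + l * - + N) (length-upTo size))) ⟩
      + size * (+ size - 1ℤ) + + 2 * (+ size * - + N)
    ≡⟨ cong (λ m → m * (m - 1ℤ) + + 2 * (m * - + N)) +size≡M ⟩
      M * (M - 1ℤ) + + 2 * (M * - + N)
    ≡⟨ vanish (+ N) ⟩
      + 2 * 0ℤ
    ∎)
    where
      open ≡-Reasoning
      vanish : ∀ n → (+ 1 + + 2 * n) * (+ 1 + + 2 * n - 1ℤ) + + 2 * ((+ 1 + + 2 * n) * - n) ≡ + 2 * 0ℤ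
      vanish = solve-∀

  ∑-range-square : + 6 * (∑[ a ∈ range N ] a * a) ≡ + 2 * + N * (+ N + 1ℤ) * M
  ∑-range-square = begin
      + 6 * (∑[ a ∈ range N ] a * a)
    ≡⟨ cong (+ 6 *_) (trans (∑-map (λ k → + k - + N) (upTo size) (λ a → a * a))
                      (trans (∑-cong (upTo size) (λ k → expand (+ k) (+ N)))
                             (∑-quartic (upTo size) (λ k → + k) (+ N * + N) (- (+ 2 * + N)) 1ℤ 0ℤ 0ℤ))) ⟩
      + 6 * (+ N * + N * + length (upTo size) + - (+ 2 * + N) * K₁ + 1ℤ * K₂ + 0ℤ * K₃ + 0ℤ * K₄)
    ≡⟨ regroup (+ N) (+ length (upTo size)) K₁ K₂ K₃ K₄ ⟩
      + 6 * (+ N * + N) * + length (upTo size) - + 6 * + N * (+ 2 * K₁) + + 6 * K₂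
    ≡⟨ cong (λ l → + 6 * (+ N * + N) * + l - + 6 * + N * (+ 2 * K₁) + + 6 * K₂) (length-upTo size) ⟩
      + 6 * (+ N * + N) * + size - + 6 * + N * (+ 2 * K₁) + + 6 * K₂
    ≡⟨ cong₂ (λ s t → + 6 * (+ N * + N) * + size - + 6 * + N * s + t) (∑-upTo-id size) (∑-upTo-square size) ⟩
      + 6 * (+ N * + N) * + size - + 6 * + N * (+ size * (+ size - 1ℤ))
        + (+ size - 1ℤ) * + size * (+ 2 * + size - 1ℤ)
    ≡⟨ cong (λ m → + 6 * (+ N * + N) * m - + 6 * + N * (m * (m - 1ℤ)) + (m - 1ℤ) * m * (+ 2 * m - 1ℤ)) +size≡M ⟩
      + 6 * (+ N * + N) * M - + 6 * + N * (M * (M - 1ℤ)) + (M - 1ℤ) * M * (+ 2 * M - 1ℤ)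
    ≡⟨ simplify (+ N) ⟩
      + 2 * + N * (+ N + 1ℤ) * M
    ∎
    where
      open ≡-Reasoning
      K₁ K₂ K₃ K₄ : ℤ
      K₁ = ∑[ k ∈ upTo size ] + k
      K₂ = ∑[ k ∈ upTo size ] + k * + k
      K₃ = ∑[ k ∈ upTo size ] + k * + k * + k
      K₄ = ∑[ k ∈ upTo size ] + k * + k * + k * + k
      expand : ∀ k n → (k - n) * (k - n)
             ≡ n * n + - (+ 2 * n) * k + 1ℤ * (k * k) + 0ℤ * (k * k * k) + 0ℤ * (k * k * k * k)
      expand = solve-∀
      regroup : ∀ n m k₁ k₂ k₃ k₄ → + 6 * (n * n * m + - (+ 2 * n) * k₁ + 1ℤ * k₂ + 0ℤ * k₃ + 0ℤ * k₄)
              ≡ + 6 * (n * n) * m - + 6 * n * (+ 2 * k₁) + + 6 * k₂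
      regroup = solve-∀
      simplify : ∀ n → let m = + 1 + + 2 * n in
                 + 6 * (n * n) * m - + 6 * n * (m * (m - 1ℤ)) + (m - 1ℤ) * m * (+ 2 * m - 1ℤ)
               ≡ + 2 * n * (n + 1ℤ) * m
      simplify = solve-∀

  ∈-range⁻ : ∀ {a} → a ∈ range N → - + N ≤ a × a ≤ + N
  ∈-range⁻ a∈ with ∈-map⁻ (λ k → + k - + N) a∈
  ... | k , k∈ , refl = lower , upper
    where
      lower : - + N ≤ + k - + N
      lower = subst (_≤ + k - + N) (ℤP.+-identityˡ (- + N)) (ℤP.+-monoˡ-≤ (- + N) (+≤+ z≤n))
      upper : + k - + N ≤ + N
      upper = ℤP.≤-trans (ℤP.+-monoˡ-≤ (- + N) (+≤+ (ℕP.≤-pred (∈-upTo⁻ k∈))))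
                         (ℤP.≤-reflexive (trans (cong (_- + N) (ℤP.pos-* 2 N)) (halve (+ N))))
        where halve : ∀ n → + 2 * n - n ≡ n
              halve = solve-∀

0≤n*[n-1] : ∀ n → 0ℤ ≤ + n * (+ n - 1ℤ)
0≤n*[n-1] zero    = +≤+ z≤n
0≤n*[n-1] (suc m) = 0≤i*j {+ suc m} {+ m} (+≤+ z≤n) (+≤+ z≤n)

diff : ℤ × ℤ → ℤ
diff (a , b) = a - b

module CoefficientDifferences (N : ℕ) where
  open CoefficientRange N

  pairs : List (ℤ × ℤ)
  pairs = cartesianProduct (range N) (range N)

  -- three times the mean of (a - b)² over pairs, by ∑-range-square
  c : ℤ
  c = + 2 * + N * (+ N + 1ℤ)

  centredSquare : ℤ × ℤ → ℤ
  centredSquare ab = + 3 * (diff ab * diff ab) - c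

  ∑-diff : ∑ pairs diff ≡ 0ℤ
  ∑-diff = begin
      ∑ pairs diff
    ≡⟨ ∑-cartesianProduct (range N) (range N) diff ⟩
      ∑[ a ∈ range N ] ∑[ b ∈ range N ] a + - b
    ≡⟨ ∑∑-+ (range N) (range N) (λ a → a) (λ b → - b) ⟩
      (∑[ a ∈ range N ] a) * + length (range N) + + length (range N) * (∑[ b ∈ range N ] - b)
    ≡⟨ cong₂ (λ s t → s * + length (range N) + + length (range N) * t)
             ∑-range-id (trans (∑-neg (range N) (λ b → b)) (cong -_ ∑-range-id)) ⟩
      0ℤ * + length (range N) + + length (range N) * 0ℤ
    ≡⟨ cong (_+_ 0ℤ) (ℤP.*-zeroʳ (+ length (range N))) ⟩
      0ℤ
    ∎
    where open ≡-Reasoning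

  ∑-centredSquare : ∑ pairs centredSquare ≡ 0ℤ
  ∑-centredSquare = begin
      ∑ pairs centredSquare
    ≡⟨ ∑-distrib-+ pairs (λ ab → + 3 * (diff ab * diff ab)) (λ _ → - c) ⟩
      ∑ pairs (λ ab → + 3 * (diff ab * diff ab)) + ∑ pairs (λ _ → - c)
    ≡⟨ cong₂ _+_ (trans (∑-*ˡ pairs (+ 3) (λ ab → diff ab * diff ab))
                        (cong (+ 3 *_) (∑-cartesianProduct (range N) (range N) (λ ab → diff ab * diff ab))))
                 (∑-const pairs (- c)) ⟩
      + 3 * (∑[ a ∈ range N ] ∑[ b ∈ range N ] (a + - b) * (a + - b)) + + length pairs * - c
    ≡⟨ cong₂ (λ s l → + 3 * s + l * - c) (∑∑-+² (range N) (range N) (λ a → a) (λ b → - b)) length-pairs ⟩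
      + 3 * (Q * m + + 2 * (∑[ a ∈ range N ] a) * (∑[ b ∈ range N ] - b) + m * (∑[ b ∈ range N ] - b * - b))
        + m * m * - c
    ≡⟨ cong₂ (λ s t → + 3 * (Q * m + + 2 * s * (∑[ b ∈ range N ] - b) + m * t) + m * m * - c)
             ∑-range-id (∑-cong (range N) neg-square) ⟩
      + 3 * (Q * m + + 2 * 0ℤ * (∑[ b ∈ range N ] - b) + m * Q) + m * m * - c
    ≡⟨ factor Q m c (∑[ b ∈ range N ] - b) ⟩
      m * (+ 6 * Q - c * m)
    ≡⟨ cong (λ t → m * (+ 6 * Q - c * t)) length-range ⟩
      m * (+ 6 * Q - c * M)
    ≡⟨ cong (λ t → m * (t - c * M)) ∑-range-square ⟩
      m * (c * M - c * M)
    ≡⟨ cancel m (c * M) ⟩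
      0ℤ
    ∎
    where
      open ≡-Reasoning
      m Q : ℤ
      m = + length (range N)
      Q = ∑[ a ∈ range N ] a * a
      length-pairs : + length pairs ≡ m * m
      length-pairs = begin
          + length pairs
        ≡⟨ length≡∑1 pairs ⟩
          ∑ pairs (λ _ → 1ℤ)
        ≡⟨ ∑-cartesianProduct (range N) (range N) (λ _ → 1ℤ) ⟩
          ∑[ a ∈ range N ] ∑[ b ∈ range N ] 1ℤ
        ≡⟨ ∑-cong (range N) (λ _ → sym (length≡∑1 (range N))) ⟩
          ∑[ a ∈ range N ] m
        ≡⟨ ∑-const (range N) m ⟩
          m * m
        ∎
      factor : ∀ q m c s → + 3 * (q * m + + 2 * 0ℤ * s + m * q) + m * m * - c ≡ m * (+ 6 * q - c * m)
      factor = solve-∀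
      cancel : ∀ m x → m * (x - x) ≡ 0ℤ
      cancel = solve-∀
      neg-square : ∀ b → - b * - b ≡ b * b
      neg-square = solve-∀

  diff²≤ : ∀ ab → ab ∈ pairs → diff ab * diff ab ≤ (+ 2 * + N) * (+ 2 * + N)
  diff²≤ (a , b) ab∈ with ∈-cartesianProduct⁻ (range N) (range N) ab∈
  ... | a∈ , b∈ with ∈-range⁻ a∈ | ∈-range⁻ b∈
  ... | -N≤a , a≤N | -N≤b , b≤N = i*i≤j*j lower upper
    where
      double : ∀ n → n + n ≡ + 2 * n
      double = solve-∀
      lower : - (+ 2 * + N) ≤ a - b
      lower = subst (_≤ a - b) (trans (sym (ℤP.neg-distrib-+ (+ N) (+ N))) (cong -_ (double (+ N))))
                (ℤP.+-mono-≤ -N≤a (ℤP.neg-mono-≤ b≤N))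
      upper : a - b ≤ + 2 * + N
      upper = subst (a - b ≤_) (double (+ N))
                (ℤP.+-mono-≤ a≤N (subst (- b ≤_) (ℤP.neg-involutive (+ N)) (ℤP.neg-mono-≤ -N≤b)))

  c≤12N² : c ≤ + 12 * (+ N * + N)
  c≤12N² = ≤-by-gap (+ 2 * (+ N * (+ N - 1ℤ)) + + 8 * (+ N * + N))
    (ℤP.+-mono-≤ (0≤i*j {+ 2} (+≤+ z≤n) (0≤n*[n-1] N)) (0≤i*j {+ 8} (+≤+ z≤n) (0≤i*i (+ N))))
    (split (+ N))
    where split : ∀ n → + 12 * (n * n) ≡ + 2 * n * (n + 1ℤ) + (+ 2 * (n * (n - 1ℤ)) + + 8 * (n * n))
          split = solve-∀

  centredSquare²≤ : ∀ ab → ab ∈ pairs →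
    centredSquare ab * centredSquare ab ≤ (+ 12 * (+ N * + N)) * (+ 12 * (+ N * + N))
  centredSquare²≤ ab ab∈ = i*i≤j*j lower upper
    where
      d² T : ℤ
      d² = diff ab * diff ab
      T = + 12 * (+ N * + N)
      0≤c : 0ℤ ≤ c
      0≤c = 0≤i*j {+ 2 * + N} {+ N + 1ℤ} (0≤i*j {+ 2} {+ N} (+≤+ z≤n) (+≤+ z≤n)) (+≤+ z≤n)
      lower : - T ≤ + 3 * d² - c
      lower = ≤-by-gap (+ 3 * d² + (T - c))
        (ℤP.+-mono-≤ (0≤i*j {+ 3} (+≤+ z≤n) (0≤i*i (diff ab))) (ℤP.i≤j⇒0≤j-i c≤12N²))
        (split₁ d² T c)
        where split₁ : ∀ d t c → + 3 * d - c ≡ - t + (+ 3 * d + (t - c))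
              split₁ = solve-∀
      upper : + 3 * d² - c ≤ T
      upper = ≤-by-gap (+ 3 * ((+ 2 * + N) * (+ 2 * + N) - d²) + c)
        (ℤP.+-mono-≤ (0≤i*j {+ 3} (+≤+ z≤n) (ℤP.i≤j⇒0≤j-i (diff²≤ ab ab∈))) 0≤c)
        (split₂ d² (+ N) c)
        where split₂ : ∀ d n c → + 12 * (n * n) ≡ + 3 * d - c + (+ 3 * ((+ 2 * n) * (+ 2 * n) - d) + c)
              split₂ = solve-∀

tuples≡tuplesOf : ∀ N n → tuples N n ≡ tuplesOf (range N) n
tuples≡tuplesOf N zero    = refl
tuples≡tuplesOf N (suc n) = cong (λ T → concatMap (λ a → map (a ∷_) T) (range N)) (tuples≡tuplesOf N n)

toEltPair : List (ℤ × ℤ) → Elt × Elt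
toEltPair z = toElt (map proj₁ z) , toElt (map proj₂ z)

∑-Bset² : ∀ p N (F : Elt × Elt → ℤ) →
  ∑ (cartesianProduct (Bset p N) (Bset p N)) F
  ≡ ∑[ z ∈ tuplesOf (CoefficientDifferences.pairs N) (p ℕ.∸ 1) ] F (toEltPair z)
∑-Bset² p N F = begin
    ∑ (cartesianProduct (map toElt T) (map toElt T)) F
  ≡⟨ ∑-cartesianProduct (map toElt T) (map toElt T) F ⟩
    ∑[ α ∈ map toElt T ] ∑[ β ∈ map toElt T ] F (α , β)
  ≡⟨ trans (∑-map toElt T _) (∑-cong T (λ t → ∑-map toElt T _)) ⟩
    ∑[ t ∈ T ] ∑[ u ∈ T ] F (toElt t , toElt u)
  ≡⟨ cong (λ T′ → ∑[ t ∈ T′ ] ∑[ u ∈ T′ ] F (toElt t , toElt u)) (tuples≡tuplesOf N (p ℕ.∸ 1)) ⟩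
    ∑[ t ∈ tuplesOf (range N) (p ℕ.∸ 1) ] ∑[ u ∈ tuplesOf (range N) (p ℕ.∸ 1) ] F (toElt t , toElt u)
  ≡⟨ ∑-tuplesOf-pairs (range N) (range N) (p ℕ.∸ 1) (λ t u → F (toElt t , toElt u)) ⟩
    ∑[ z ∈ tuplesOf (CoefficientDifferences.pairs N) (p ℕ.∸ 1) ] F (toEltPair z)
  ∎
  where
    open ≡-Reasoning
    T = tuples N (p ℕ.∸ 1)

-- Residues modulo a prime

∣∧0<∧<2*⇒≡ : ∀ {p m} → p ∣ m → 0 ℕ.< m → m ℕ.< 2 ℕ.* p → m ≡ p
∣∧0<∧<2*⇒≡         (divides zero          refl) ()
∣∧0<∧<2*⇒≡ {p}     (divides (suc zero)    refl) _ _ = ℕP.+-identityʳ p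
∣∧0<∧<2*⇒≡ {p} {m} (divides (suc (suc q)) refl) _ m<2p =
  ⊥-elim (ℕP.<⇒≱ m<2p (ℕP.≤-trans (ℕP.m≤m+n (2 ℕ.* p) (q ℕ.* p)) (ℕP.≤-reflexive (expand p q))))
  where expand : ∀ p q → 2 ℕ.* p ℕ.+ q ℕ.* p ≡ suc (suc q) ℕ.* p
        expand = ℕ-Solver.solve-∀

prime∤pred : ∀ {n} → Prime (suc n) → ¬ suc n ∣ n
prime∤pred {zero}  isPrime _ = ¬prime[1] isPrime
prime∤pred {suc n} _       = >⇒∤ ℕP.≤-refl

module ResiduesModPrime {n : ℕ} (isPrime : Prime (suc n)) where

  p : ℕ
  p = suc n

  p∤n : ¬ p ∣ n
  p∤n = prime∤pred isPrime

  p∤nonzero : ∀ {k} → 0 ℕ.< k → k ℕ.< p → ¬ p ∣ k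
  p∤nonzero {suc _} _ k<p = >⇒∤ k<p

  complement : ∀ {i j} → 0 ℕ.< i → i ℕ.< p → j ℕ.< p → p ∣ i ℕ.+ j → i ℕ.+ j ≡ p
  complement {i} {j} 0<i i<p j<p p∣i+j = ∣∧0<∧<2*⇒≡ p∣i+j
    (ℕP.<-≤-trans 0<i (ℕP.m≤m+n i j))
    (ℕP.<-≤-trans (ℕP.+-mono-<-≤ i<p (ℕP.<⇒≤ j<p)) (ℕP.≤-reflexive (cong (p ℕ.+_) (sym (ℕP.+-identityʳ p)))))

  coprime : ∀ {m} → ¬ p ∣ m → Coprime m p
  coprime p∤m (d∣m , d∣p) with prime⇒irreducible isPrime d∣p
  ... | inj₁ d≡1 = d≡1
  ... | inj₂ refl = ⊥-elim (p∤m d∣m)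

  -- p ∣ k m + n says k m ≡ 1 (mod p), since n ≡ -1.
  inverse : ∀ {m} → ¬ p ∣ m → ∃[ k ] 0 ℕ.< k × k ℕ.< p × p ∣ k ℕ.* m ℕ.+ n
  inverse {m} p∤m = reduce (fromBézout (coprime-Bézout (coprime p∤m)))
    where
      fromBézout : Bézout.Identity 1 m p → ∃[ x ] p ∣ x ℕ.* m ℕ.+ n
      fromBézout (Bézout.+- x y eq) = x , divides (suc y) (trans (cong (ℕ._+ n) (sym eq)) (expand n y))
        where expand : ∀ n y → 1 ℕ.+ y ℕ.* suc n ℕ.+ n ≡ suc y ℕ.* suc n
              expand = ℕ-Solver.solve-∀
      fromBézout (Bézout.-+ x y eq) = n ℕ.* x , divides (n ℕ.* y)
        (trans (factor n x m) (trans (cong (n ℕ.*_) eq) (sym (ℕP.*-assoc n y p))))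
        where factor : ∀ n x m → n ℕ.* x ℕ.* m ℕ.+ n ≡ n ℕ.* (1 ℕ.+ x ℕ.* m)
              factor = ℕ-Solver.solve-∀
      reduce : ∃[ x ] p ∣ x ℕ.* m ℕ.+ n → ∃[ k ] 0 ℕ.< k × k ℕ.< p × p ∣ k ℕ.* m ℕ.+ n
      reduce (x , p∣xm+n) = x % p , 0<x%p , m%n<n x p , p∣km+n
        where
          split : x ℕ.* m ℕ.+ n ≡ (x / p) ℕ.* m ℕ.* p ℕ.+ ((x % p) ℕ.* m ℕ.+ n)
          split = trans (cong (λ y → y ℕ.* m ℕ.+ n) (m≡m%n+[m/n]*n x p)) (regroup (x % p) (x / p) m n)
            where regroup : ∀ r q m n →
                            (r ℕ.+ q ℕ.* suc n) ℕ.* m ℕ.+ n ≡ q ℕ.* m ℕ.* suc n ℕ.+ (r ℕ.* m ℕ.+ n)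
                  regroup = ℕ-Solver.solve-∀
          p∣km+n : p ∣ (x % p) ℕ.* m ℕ.+ n
          p∣km+n = ∣m+n∣m⇒∣n (subst (p ∣_) split p∣xm+n) (n∣m*n ((x / p) ℕ.* m))
          0<x%p : 0 ℕ.< x % p
          0<x%p with x % p | p∣km+n
          ... | zero  | p∣n = ⊥-elim (p∤n p∣n)
          ... | suc _ | _   = s≤s z≤n

  private
    inverse-unique-≤ : ∀ {m k k′} → ¬ p ∣ m → k ℕ.≤ k′ → k′ ℕ.< p →
                       p ∣ k ℕ.* m ℕ.+ n → p ∣ k′ ℕ.* m ℕ.+ n → k ≡ k′
    inverse-unique-≤ {m} {k} p∤m k≤k′ k′<p p∣k p∣k′ with ℕP.m≤n⇒∃[o]m+o≡n k≤k′
    ... | d , refl with euclidsLemma d m isPrime (∣m+n∣m⇒∣n (subst (p ∣_) (regroup k d m n) p∣k′) p∣k)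
      where regroup : ∀ k d m n → (k ℕ.+ d) ℕ.* m ℕ.+ n ≡ (k ℕ.* m ℕ.+ n) ℕ.+ d ℕ.* m
            regroup = ℕ-Solver.solve-∀
    ... | inj₂ p∣m = ⊥-elim (p∤m p∣m)
    ... | inj₁ p∣d with d
    ...   | zero  = sym (ℕP.+-identityʳ k)
    ...   | suc d′ = ⊥-elim (p∤nonzero (s≤s z≤n) (ℕP.≤-<-trans (ℕP.m≤n+m (suc d′) k) k′<p) p∣d)

  inverse-unique : ∀ {m k k′} → ¬ p ∣ m → k ℕ.< p → k′ ℕ.< p →
                   p ∣ k ℕ.* m ℕ.+ n → p ∣ k′ ℕ.* m ℕ.+ n → k ≡ k′
  inverse-unique {k = k} {k′} p∤m k<p k′<p p∣k p∣k′ with ℕP.≤-total k k′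
  ... | inj₁ k≤k′ = inverse-unique-≤ p∤m k≤k′ k′<p p∣k p∣k′
  ... | inj₂ k′≤k = sym (inverse-unique-≤ p∤m k′≤k k<p p∣k′ p∣k)

-- Traces and norms in ℚ(ω)

sumℤ-map : ∀ (f : A → ℤ) xs → sumℤ (map f xs) ≡ ∑ xs f
sumℤ-map f []       = refl
sumℤ-map f (x ∷ xs) = cong (_+_ (f x)) (sumℤ-map f xs)

if-does≡𝟙* : ∀ {P : Set} (P? : Dec P) a → (if does P? then a else 0ℤ) ≡ 𝟙 P? * a
if-does≡𝟙* P? a with does P?
... | true  = sym (ℤP.*-identityˡ a)
... | false = refl

extend : (ℕ → ℤ) → Elt → ℤ
extend w α = ∑ α (λ (i , a) → w i * a)

-- ω^i contributes to ratValue p as 1 if i ≡ 0, as -1 if i ≡ 1 (mod p), and not otherwise.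
unitValue : ℕ → ℕ → ℤ
unitValue p i = 𝟙 (p ∣? i) - 𝟙 (p ∣? i ℕ.+ (p ∸ 1))

traceOfPower : ℕ → ℕ → ℤ
traceOfPower p m = ∑[ k ∈ galIdx p ] unitValue p (k ℕ.* m)

ratValue≡extend : ∀ p v → ratValue p v ≡ extend (unitValue p) v
ratValue≡extend p v = begin
    coeff0 p v - coeff1 p v
  ≡⟨ cong₂ _-_ (trans (sumℤ-map _ v) (∑-cong v (λ (i , a) → if-does≡𝟙* (p ∣? i) a)))
               (trans (sumℤ-map _ v) (∑-cong v (λ (i , a) → if-does≡𝟙* (p ∣? i ℕ.+ (p ∸ 1)) a))) ⟩
    ∑ v (λ (i , a) → 𝟙 (p ∣? i) * a) - ∑ v (λ (i , a) → 𝟙 (p ∣? i ℕ.+ (p ∸ 1)) * a)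
  ≡⟨ cong (_+_ (∑ v (λ (i , a) → 𝟙 (p ∣? i) * a))) (sym (∑-neg v _)) ⟩
    ∑ v (λ (i , a) → 𝟙 (p ∣? i) * a) + ∑ v (λ (i , a) → - (𝟙 (p ∣? i ℕ.+ (p ∸ 1)) * a))
  ≡⟨ sym (∑-distrib-+ v _ _) ⟩
    ∑ v (λ (i , a) → 𝟙 (p ∣? i) * a + - (𝟙 (p ∣? i ℕ.+ (p ∸ 1)) * a))
  ≡⟨ ∑-cong v (λ (i , a) → factor (𝟙 (p ∣? i)) (𝟙 (p ∣? i ℕ.+ (p ∸ 1))) a) ⟩
    extend (unitValue p) v
  ∎
  where
    open ≡-Reasoning
    factor : ∀ x y a → x * a + - (y * a) ≡ (x - y) * a
    factor = solve-∀

Tr≡extend : ∀ p α → Tr p α ≡ extend (traceOfPower p) α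
Tr≡extend p α = begin
    Tr p α
  ≡⟨ ratValue≡extend p (concatMap (λ k → σ k α) (galIdx p)) ⟩
    extend (unitValue p) (concatMap (λ k → σ k α) (galIdx p))
  ≡⟨ ∑-concatMap (λ k → σ k α) (galIdx p) _ ⟩
    ∑[ k ∈ galIdx p ] extend (unitValue p) (σ k α)
  ≡⟨ ∑-cong (galIdx p) (λ k → ∑-map _ α _) ⟩
    ∑[ k ∈ galIdx p ] ∑ α (λ (i , a) → unitValue p (k ℕ.* i) * a)
  ≡⟨ ∑-comm (galIdx p) α _ ⟩
    ∑ α (λ (i , a) → ∑[ k ∈ galIdx p ] unitValue p (k ℕ.* i) * a)
  ≡⟨ ∑-cong α (λ (i , a) → ∑-*ʳ (galIdx p) a (λ k → unitValue p (k ℕ.* i))) ⟩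
    extend (traceOfPower p) α
  ∎
  where open ≡-Reasoning

length-galIdx : ∀ n → length (galIdx (suc n)) ≡ n
length-galIdx n = trans (length-map suc (upTo n)) (length-upTo n)

∈-galIdx⁻ : ∀ {n k} → k ∈ galIdx (suc n) → 0 ℕ.< k × k ℕ.< suc n
∈-galIdx⁻ k∈ with ∈-map⁻ suc k∈
... | j , j∈ , refl = s≤s z≤n , s≤s (∈-upTo⁻ j∈)

∑-galIdx-δ : ∀ n {a} (f : ℕ → ℤ) → 0 ℕ.< a → a ℕ.< suc n →
             (∀ k → 0 ℕ.< k → k ℕ.< suc n → k ≢ a → f k ≡ 0ℤ) → ∑ (galIdx (suc n)) f ≡ f a
∑-galIdx-δ n {suc a} f _ a<p f≡0 = trans (∑-map suc (upTo n) f)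
  (∑-upTo-δ n (λ k → f (suc k)) (ℕP.≤-pred a<p)
    (λ k k<n k≢a → f≡0 (suc k) (s≤s z≤n) (s≤s k<n) (λ { refl → k≢a refl })))

module TracesModPrime {n : ℕ} (isPrime : Prime (suc n)) where
  open ResiduesModPrime isPrime

  traceOfPower-∣ : ∀ {m} → p ∣ m → traceOfPower p m ≡ + n
  traceOfPower-∣ {m} p∣m = begin
      ∑[ k ∈ galIdx p ] unitValue p (k ℕ.* m)
    ≡⟨ ∑-cong (galIdx p) (λ k → cong₂ _-_ (𝟙-yes (p ∣? k ℕ.* m) (∣n⇒∣m*n k p∣m))
                                          (𝟙-no (p ∣? k ℕ.* m ℕ.+ n) (p∤n ∘ p∣km+n⇒p∣n k))) ⟩
      ∑[ k ∈ galIdx p ] (1ℤ - 0ℤ)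
    ≡⟨ ∑-const (galIdx p) (1ℤ - 0ℤ) ⟩
      + length (galIdx p) * 1ℤ
    ≡⟨ trans (ℤP.*-identityʳ _) (cong +_ (length-galIdx n)) ⟩
      + n
    ∎
    where
      open ≡-Reasoning
      p∣km+n⇒p∣n : ∀ k → p ∣ k ℕ.* m ℕ.+ n → p ∣ n
      p∣km+n⇒p∣n k p∣km+n = ∣m+n∣m⇒∣n p∣km+n (∣n⇒∣m*n k p∣m)

  traceOfPower-∤ : ∀ {m} → ¬ p ∣ m → traceOfPower p m ≡ - 1ℤ
  traceOfPower-∤ {m} p∤m = viaInverse (inverse p∤m)
    where
    p∤km : ∀ {k} → k ∈ galIdx p → ¬ p ∣ k ℕ.* m
    p∤km {k} k∈ p∣km with euclidsLemma k m isPrime p∣km | ∈-galIdx⁻ k∈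
    ... | inj₁ p∣k | 0<k , k<p = p∤nonzero 0<k k<p p∣k
    ... | inj₂ p∣m | _         = p∤m p∣m
    viaInverse : ∃[ k ] 0 ℕ.< k × k ℕ.< p × p ∣ k ℕ.* m ℕ.+ n → traceOfPower p m ≡ - 1ℤ
    viaInverse (k₀ , 0<k₀ , k₀<p , p∣k₀m+n) = begin
        ∑[ k ∈ galIdx p ] unitValue p (k ℕ.* m)
      ≡⟨ ∑-cong-∈ (galIdx p) (λ k k∈ → trans (cong (_- 𝟙 (p ∣? k ℕ.* m ℕ.+ n)) (𝟙-no (p ∣? k ℕ.* m) (p∤km k∈)))
                                              (ℤP.+-identityˡ (- 𝟙 (p ∣? k ℕ.* m ℕ.+ n)))) ⟩
        ∑[ k ∈ galIdx p ] - 𝟙 (p ∣? k ℕ.* m ℕ.+ n)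
      ≡⟨ ∑-neg (galIdx p) (λ k → 𝟙 (p ∣? k ℕ.* m ℕ.+ n)) ⟩
        - (∑[ k ∈ galIdx p ] 𝟙 (p ∣? k ℕ.* m ℕ.+ n))
      ≡⟨ cong -_ (∑-galIdx-δ n (λ k → 𝟙 (p ∣? k ℕ.* m ℕ.+ n)) 0<k₀ k₀<p
           (λ k _ k<p k≢k₀ → 𝟙-no (p ∣? k ℕ.* m ℕ.+ n) (λ p∣ → k≢k₀ (inverse-unique p∤m k<p k₀<p p∣ p∣k₀m+n)))) ⟩
        - 𝟙 (p ∣? k₀ ℕ.* m ℕ.+ n)
      ≡⟨ cong -_ (𝟙-yes (p ∣? k₀ ℕ.* m ℕ.+ n) p∣k₀m+n) ⟩
        - 1ℤ
      ∎
      where open ≡-Reasoning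

  traceOfPower-prime : ∀ m → traceOfPower p m ≡ + p * 𝟙 (p ∣? m) - 1ℤ
  traceOfPower-prime m = byCases (p ∣? m)
    where
    -- Case on the decision itself: `with p ∣? m` cannot abstract `does (p ∣? m)`, which the goal
    -- shows unfolded to a `_%_` test.
    byCases : (p∣?m : Dec (p ∣ m)) → traceOfPower p m ≡ + p * 𝟙 p∣?m - 1ℤ
    byCases (yes p∣m) = trans (traceOfPower-∣ p∣m) (shift (+ n))
      where shift : ∀ n → n ≡ (1ℤ + n) * 1ℤ - 1ℤ
            shift = solve-∀
    byCases (no p∤m)  = trans (traceOfPower-∤ p∤m) (cong (_- 1ℤ) (sym (ℤP.*-zeroʳ (+ p))))

∈-toEltFrom⁻ : ∀ {k cs x} → x ∈ toEltFrom k cs → k ℕ.≤ proj₁ x × proj₁ x ℕ.< k ℕ.+ length cs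
∈-toEltFrom⁻ {k} {c ∷ cs} (here refl) = ℕP.≤-refl , ℕP.m<m+n k (s≤s z≤n)
∈-toEltFrom⁻ {k} {c ∷ cs} {x} (there x∈) with ∈-toEltFrom⁻ x∈
... | k<i , i<k+1+l = ℕP.<⇒≤ k<i , subst (proj₁ x ℕ.<_) (sym (ℕP.+-suc k (length cs))) i<k+1+l

∑-toEltFrom-coeff : ∀ k cs (f : ℤ → ℤ) → ∑ (toEltFrom k cs) (λ (_ , a) → f a) ≡ ∑ cs f
∑-toEltFrom-coeff k []       f = refl
∑-toEltFrom-coeff k (c ∷ cs) f = cong (_+_ (f c)) (∑-toEltFrom-coeff (suc k) cs f)

∑-toEltFrom-diagonal : ∀ k cs →
  ∑[ x ∈ toEltFrom k cs ] ∑[ y ∈ toEltFrom k cs ] 𝟙 (proj₁ x ℕ.≟ proj₁ y) * (proj₂ x * proj₂ y)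
  ≡ ∑[ c ∈ cs ] c * c
∑-toEltFrom-diagonal k []       = refl
∑-toEltFrom-diagonal k (c ∷ cs) = begin
    (𝟙 (k ℕ.≟ k) * (c * c) + (∑[ y ∈ E ] 𝟙 (k ℕ.≟ proj₁ y) * (c * proj₂ y)))
    + (∑[ x ∈ E ] 𝟙 (proj₁ x ℕ.≟ k) * (proj₂ x * c) + (∑[ y ∈ E ] 𝟙 (proj₁ x ℕ.≟ proj₁ y) * (proj₂ x * proj₂ y)))
  ≡⟨ cong₂ _+_ (cong₂ _+_ (trans (cong (_* (c * c)) (𝟙-yes (k ℕ.≟ k) refl)) (ℤP.*-identityˡ (c * c)))
                          (trans (∑-cong-∈ E (λ y y∈ → off-diagonal (k ℕ.≟ proj₁ y) (ℕP.<⇒≢ (later y∈)) _))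
                                 (∑-zero E)))
               (∑-cong-∈ E (λ x x∈ → trans (cong (_+ _) (off-diagonal (proj₁ x ℕ.≟ k) (ℕP.>⇒≢ (later x∈)) _))
                                           (ℤP.+-identityˡ _))) ⟩
    (c * c + 0ℤ) + (∑[ x ∈ E ] ∑[ y ∈ E ] 𝟙 (proj₁ x ℕ.≟ proj₁ y) * (proj₂ x * proj₂ y))
  ≡⟨ cong₂ _+_ (ℤP.+-identityʳ (c * c)) (∑-toEltFrom-diagonal (suc k) cs) ⟩
    c * c + (∑[ c ∈ cs ] c * c)
  ∎
  where
    open ≡-Reasoning
    E : Elt
    E = toEltFrom (suc k) cs
    later : ∀ {x} → x ∈ E → k ℕ.< proj₁ x
    later x∈ = proj₁ (∈-toEltFrom⁻ x∈)
    off-diagonal : ∀ {i j} (i≟j : Dec (i ≡ j)) → i ≢ j → ∀ a → 𝟙 i≟j * a ≡ 0ℤ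
    off-diagonal i≟j i≢j a = trans (cong (_* a) (𝟙-no i≟j i≢j)) (ℤP.*-zeroˡ a)

Tr∘mulω≡extend : ∀ p j α → Tr p (mulω j α) ≡ extend (λ i → traceOfPower p (i ℕ.+ j)) α
Tr∘mulω≡extend p j α = trans (Tr≡extend p (mulω j α)) (∑-map _ α _)

normSq-cong : ∀ p {α β} → (∀ w → extend w α ≡ extend w β) → normSq p α ≡ normSq p β
normSq-cong p {α} {β} α≈β = begin
    normSq p α
  ≡⟨ sumℤ-map (λ j → Tr p (mulω j α) * Tr p (mulω j α)) (galIdx p) ⟩
    ∑[ j ∈ galIdx p ] Tr p (mulω j α) * Tr p (mulω j α)
  ≡⟨ ∑-cong (galIdx p) (λ j → cong (λ t → t * t) (trans (Tr∘mulω≡extend p j α)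
                                  (trans (α≈β (λ i → traceOfPower p (i ℕ.+ j))) (sym (Tr∘mulω≡extend p j β))))) ⟩
    ∑[ j ∈ galIdx p ] Tr p (mulω j β) * Tr p (mulω j β)
  ≡⟨ sym (sumℤ-map (λ j → Tr p (mulω j β) * Tr p (mulω j β)) (galIdx p)) ⟩
    normSq p β
  ∎
  where open ≡-Reasoning

extend-subE : ∀ w α β → extend w (subE α β) ≡ extend w α - extend w β
extend-subE w α β = begin
    extend w (α ++ negE β)
  ≡⟨ ∑-++ α (negE β) _ ⟩
    extend w α + extend w (negE β)
  ≡⟨ cong (_+_ (extend w α)) (trans (∑-map _ β _) (trans
       (∑-cong β (λ (i , a) → sym (ℤP.neg-distribʳ-* (w i) a))) (∑-neg β (λ (i , a) → w i * a)))) ⟩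
    extend w α - extend w β
  ∎
  where open ≡-Reasoning

extend-toEltFrom-diff : ∀ w k (z : List (ℤ × ℤ)) →
  extend w (toEltFrom k (map proj₁ z)) - extend w (toEltFrom k (map proj₂ z)) ≡ extend w (toEltFrom k (map diff z))
extend-toEltFrom-diff w k []            = refl
extend-toEltFrom-diff w k ((a , b) ∷ z) =
  trans (regroup (w k) a b _ _) (cong (_+_ (w k * (a - b))) (extend-toEltFrom-diff w (suc k) z))
  where regroup : ∀ c a b x y → c * a + x - (c * b + y) ≡ c * (a - b) + (x - y)
        regroup = solve-∀

module NormsModPrime {n : ℕ} (isPrime : Prime (suc n)) where
  open ResiduesModPrime isPrime
  open TracesModPrime isPrime

  ∑-galIdx-sift : ∀ {i} → 0 ℕ.< i → i ℕ.< p → (F : ℕ → ℤ) →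
                  ∑[ j ∈ galIdx p ] 𝟙 (p ∣? i ℕ.+ j) * F j ≡ F (p ∸ i)
  ∑-galIdx-sift {suc i} 0<i i<p F = begin
      ∑[ j ∈ galIdx p ] 𝟙 (p ∣? suc i ℕ.+ j) * F j
    ≡⟨ ∑-galIdx-δ n (λ j → 𝟙 (p ∣? suc i ℕ.+ j) * F j) (ℕP.m<n⇒0<n∸m i<p) (s≤s (ℕP.m∸n≤m n i)) vanish ⟩
      𝟙 (p ∣? suc i ℕ.+ (p ∸ suc i)) * F (p ∸ suc i)
    ≡⟨ cong (_* F (p ∸ suc i))
            (𝟙-yes (p ∣? suc i ℕ.+ (p ∸ suc i)) (subst (p ∣_) (sym (ℕP.m+[n∸m]≡n (ℕP.<⇒≤ i<p))) ∣-refl)) ⟩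
      1ℤ * F (p ∸ suc i)
    ≡⟨ ℤP.*-identityˡ (F (p ∸ suc i)) ⟩
      F (p ∸ suc i)
    ∎
    where
      open ≡-Reasoning
      vanish : ∀ k → 0 ℕ.< k → k ℕ.< p → k ≢ p ∸ suc i → 𝟙 (p ∣? suc i ℕ.+ k) * F k ≡ 0ℤ
      vanish k _ k<p k≢ = trans (cong (_* F k) (𝟙-no (p ∣? suc i ℕ.+ k) p∤)) (ℤP.*-zeroˡ (F k))
        where p∤ : ¬ p ∣ suc i ℕ.+ k
              p∤ p∣ = k≢ (trans (sym (ℕP.m+n∸m≡n (suc i) k)) (cong (_∸ suc i) (complement 0<i i<p k<p p∣)))

  𝟙-complement : ∀ {i i′} → 0 ℕ.< i → i ℕ.< p → 0 ℕ.< i′ → i′ ℕ.< p →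
                 𝟙 (p ∣? i′ ℕ.+ (p ∸ i)) ≡ 𝟙 (i ℕ.≟ i′)
  𝟙-complement {i} {i′} 0<i i<p 0<i′ i′<p = byCases (i ℕ.≟ i′)
    where
    i+[p-i]≡p : i ℕ.+ (p ∸ i) ≡ p
    i+[p-i]≡p = ℕP.m+[n∸m]≡n (ℕP.<⇒≤ i<p)
    byCases : (i≟i′ : Dec (i ≡ i′)) → 𝟙 (p ∣? i′ ℕ.+ (p ∸ i)) ≡ 𝟙 i≟i′
    byCases (yes refl) = 𝟙-yes (p ∣? i ℕ.+ (p ∸ i)) (subst (p ∣_) (sym i+[p-i]≡p) ∣-refl)
    byCases (no i≢i′)  = 𝟙-no (p ∣? i′ ℕ.+ (p ∸ i)) (λ p∣ → i≢i′ (sym (ℕP.+-cancelʳ-≡ (p ∸ i) i′ i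
      (trans (complement 0<i′ i′<p (ℕP.<-≤-trans (ℕP.∸-monoʳ-< 0<i (ℕP.<⇒≤ i<p)) ℕP.≤-refl) p∣) (sym i+[p-i]≡p)))))

  -- the coefficient of ω^(p-j) in α, for α supported on ω, …, ω^(p-1)
  negCoeff : ℕ → Elt → ℤ
  negCoeff j = extend (λ i → 𝟙 (p ∣? i ℕ.+ j))

  Tr-mulω : ∀ j α → Tr p (mulω j α) ≡ + p * negCoeff j α - extend (λ _ → 1ℤ) α
  Tr-mulω j α = begin
      Tr p (mulω j α)
    ≡⟨ Tr∘mulω≡extend p j α ⟩
      ∑ α (λ (i , a) → traceOfPower p (i ℕ.+ j) * a)
    ≡⟨ ∑-cong α (λ (i , a) → trans (cong (_* a) (traceOfPower-prime (i ℕ.+ j)))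
                                   (split (+ p) (𝟙 (p ∣? i ℕ.+ j)) a)) ⟩
      ∑ α (λ (i , a) → + p * (𝟙 (p ∣? i ℕ.+ j) * a) + - (1ℤ * a))
    ≡⟨ ∑-distrib-+ α (λ (i , a) → + p * (𝟙 (p ∣? i ℕ.+ j) * a)) (λ (_ , a) → - (1ℤ * a)) ⟩
      ∑ α (λ (i , a) → + p * (𝟙 (p ∣? i ℕ.+ j) * a)) + ∑ α (λ (_ , a) → - (1ℤ * a))
    ≡⟨ cong₂ _+_ (∑-*ˡ α (+ p) (λ (i , a) → 𝟙 (p ∣? i ℕ.+ j) * a)) (∑-neg α (λ (_ , a) → 1ℤ * a)) ⟩
      + p * negCoeff j α - extend (λ _ → 1ℤ) α
    ∎
    where
      open ≡-Reasoning
      split : ∀ p d a → (p * d - 1ℤ) * a ≡ p * (d * a) + - (1ℤ * a)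
      split = solve-∀

  module _ (cs : List ℤ) (length≡n : length cs ≡ n) where

    private
      α : Elt
      α = toElt cs

      S : ℤ
      S = ∑[ c ∈ cs ] c

      index-bounds : ∀ {x} → x ∈ α → 0 ℕ.< proj₁ x × proj₁ x ℕ.< p
      index-bounds {x} x∈ with ∈-toEltFrom⁻ x∈
      ... | 1≤i , i<1+l = 1≤i , subst (λ l → proj₁ x ℕ.< suc l) length≡n i<1+l

      extend-1≡S : extend (λ _ → 1ℤ) α ≡ S
      extend-1≡S = trans (∑-toEltFrom-coeff 1 cs (1ℤ *_)) (∑-cong cs ℤP.*-identityˡ)

    ∑-negCoeff : ∑[ j ∈ galIdx p ] negCoeff j α ≡ S
    ∑-negCoeff = begin
        ∑[ j ∈ galIdx p ] negCoeff j α
      ≡⟨ ∑-comm (galIdx p) α _ ⟩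
        ∑ α (λ (i , a) → ∑[ j ∈ galIdx p ] 𝟙 (p ∣? i ℕ.+ j) * a)
      ≡⟨ ∑-cong-∈ α (λ (i , a) x∈ → let 0<i , i<p = index-bounds x∈ in ∑-galIdx-sift 0<i i<p (λ _ → a)) ⟩
        ∑ α (λ (_ , a) → a)
      ≡⟨ ∑-toEltFrom-coeff 1 cs (λ c → c) ⟩
        S
      ∎
      where open ≡-Reasoning

    ∑-negCoeff² : ∑[ j ∈ galIdx p ] negCoeff j α * negCoeff j α ≡ ∑[ c ∈ cs ] c * c
    ∑-negCoeff² = begin
        ∑[ j ∈ galIdx p ] negCoeff j α * negCoeff j α
      ≡⟨ ∑-cong (galIdx p) (λ j → ∑-*-∑ α α _ _) ⟩
        ∑[ j ∈ galIdx p ] ∑[ x ∈ α ] ∑[ y ∈ α ] term j x * term j y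
      ≡⟨ ∑-comm (galIdx p) α _ ⟩
        ∑[ x ∈ α ] ∑[ j ∈ galIdx p ] ∑[ y ∈ α ] term j x * term j y
      ≡⟨ ∑-cong α (λ x → ∑-comm (galIdx p) α _) ⟩
        ∑[ x ∈ α ] ∑[ y ∈ α ] ∑[ j ∈ galIdx p ] term j x * term j y
      ≡⟨ ∑-cong-∈ α (λ x x∈ → ∑-cong-∈ α (λ y y∈ → collapse x∈ y∈)) ⟩
        ∑[ x ∈ α ] ∑[ y ∈ α ] 𝟙 (proj₁ x ℕ.≟ proj₁ y) * (proj₂ x * proj₂ y)
      ≡⟨ ∑-toEltFrom-diagonal 1 cs ⟩
        ∑[ c ∈ cs ] c * c
      ∎
      where
        open ≡-Reasoning
        term : ℕ → ℕ × ℤ → ℤ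
        term j (i , a) = 𝟙 (p ∣? i ℕ.+ j) * a
        regroup : ∀ d a e b → d * a * (e * b) ≡ d * (e * (a * b))
        regroup = solve-∀
        collapse : ∀ {x y} → x ∈ α → y ∈ α →
                   ∑[ j ∈ galIdx p ] term j x * term j y ≡ 𝟙 (proj₁ x ℕ.≟ proj₁ y) * (proj₂ x * proj₂ y)
        collapse {i , a} {i′ , b} x∈ y∈ with index-bounds x∈ | index-bounds y∈
        ... | 0<i , i<p | 0<i′ , i′<p = begin
            ∑[ j ∈ galIdx p ] term j (i , a) * term j (i′ , b)
          ≡⟨ ∑-cong (galIdx p) (λ j → regroup (𝟙 (p ∣? i ℕ.+ j)) a (𝟙 (p ∣? i′ ℕ.+ j)) b) ⟩
            ∑[ j ∈ galIdx p ] 𝟙 (p ∣? i ℕ.+ j) * (𝟙 (p ∣? i′ ℕ.+ j) * (a * b))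
          ≡⟨ ∑-galIdx-sift 0<i i<p (λ j → 𝟙 (p ∣? i′ ℕ.+ j) * (a * b)) ⟩
            𝟙 (p ∣? i′ ℕ.+ (p ∸ i)) * (a * b)
          ≡⟨ cong (_* (a * b)) (𝟙-complement 0<i i<p 0<i′ i′<p) ⟩
            𝟙 (i ℕ.≟ i′) * (a * b)
          ∎

    normSq-toElt : normSq p α ≡ + p * + p * (∑[ c ∈ cs ] c * c) - (+ p + 1ℤ) * (S * S)
    normSq-toElt = begin
        normSq p α
      ≡⟨ sumℤ-map (λ j → Tr p (mulω j α) * Tr p (mulω j α)) (galIdx p) ⟩
        ∑[ j ∈ galIdx p ] Tr p (mulω j α) * Tr p (mulω j α)
      ≡⟨ ∑-cong (galIdx p) (λ j → trans (cong (λ t → t * t) (trans (Tr-mulω j α) (cong (_-_ (+ p * V j)) extend-1≡S)))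
                                        (expand (+ p) S (V j))) ⟩
        ∑[ j ∈ galIdx p ] (S * S + - (+ 2 * + p * S) * V j + + p * + p * (V j * V j)
                           + 0ℤ * (V j * V j * V j) + 0ℤ * (V j * V j * V j * V j))
      ≡⟨ ∑-quartic (galIdx p) V (S * S) (- (+ 2 * + p * S)) (+ p * + p) 0ℤ 0ℤ ⟩
        S * S * + length (galIdx p) + - (+ 2 * + p * S) * (∑[ j ∈ galIdx p ] V j)
        + + p * + p * (∑[ j ∈ galIdx p ] V j * V j) + 0ℤ * V₃ + 0ℤ * V₄
      ≡⟨ cong₂ (λ l s → S * S * + l + - (+ 2 * + p * S) * s + + p * + p * (∑[ j ∈ galIdx p ] V j * V j) + 0ℤ * V₃ + 0ℤ * V₄)
               (length-galIdx n) ∑-negCoeff ⟩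
        S * S * + n + - (+ 2 * + p * S) * S + + p * + p * (∑[ j ∈ galIdx p ] V j * V j) + 0ℤ * V₃ + 0ℤ * V₄
      ≡⟨ cong (λ q → S * S * + n + - (+ 2 * + p * S) * S + + p * + p * q + 0ℤ * V₃ + 0ℤ * V₄) ∑-negCoeff² ⟩
        S * S * + n + - (+ 2 * + p * S) * S + + p * + p * (∑[ c ∈ cs ] c * c) + 0ℤ * V₃ + 0ℤ * V₄
      ≡⟨ collect (+ n) S (∑[ c ∈ cs ] c * c) V₃ V₄ ⟩
        + p * + p * (∑[ c ∈ cs ] c * c) - (+ p + 1ℤ) * (S * S)
      ∎
      where
        open ≡-Reasoning
        V : ℕ → ℤ
        V j = negCoeff j α
        V₃ V₄ : ℤ
        V₃ = ∑[ j ∈ galIdx p ] V j * V j * V j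
        V₄ = ∑[ j ∈ galIdx p ] V j * V j * V j * V j
        expand : ∀ p s v → (p * v - s) * (p * v - s)
               ≡ s * s + - (+ 2 * p * s) * v + p * p * (v * v) + 0ℤ * (v * v * v) + 0ℤ * (v * v * v * v)
        expand = solve-∀
        collect : ∀ n s q t₃ t₄ → s * s * n + - (+ 2 * (1ℤ + n) * s) * s + (1ℤ + n) * (1ℤ + n) * q + 0ℤ * t₃ + 0ℤ * t₄
                ≡ (1ℤ + n) * (1ℤ + n) * q - (1ℤ + n + 1ℤ) * (s * s)
        collect = solve-∀

  normSq-difference : ∀ (z : List (ℤ × ℤ)) → length z ≡ n →
    normSq p (subE (toElt (map proj₁ z)) (toElt (map proj₂ z)))
    ≡ + p * + p * (∑[ ab ∈ z ] diff ab * diff ab) - (+ p + 1ℤ) * (∑ z diff * ∑ z diff)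
  normSq-difference z length≡n = begin
      normSq p (subE (toElt (map proj₁ z)) (toElt (map proj₂ z)))
    ≡⟨ normSq-cong p (λ w → trans (extend-subE w (toElt (map proj₁ z)) (toElt (map proj₂ z)))
                                  (extend-toEltFrom-diff w 1 z)) ⟩
      normSq p (toElt (map diff z))
    ≡⟨ normSq-toElt (map diff z) (trans (length-map diff z) length≡n) ⟩
      + p * + p * (∑[ c ∈ map diff z ] c * c) - (+ p + 1ℤ) * ((∑[ c ∈ map diff z ] c) * (∑[ c ∈ map diff z ] c))
    ≡⟨ cong₂ (λ q s → + p * + p * q - (+ p + 1ℤ) * (s * s))
             (∑-map diff z (λ c → c * c)) (∑-map diff z (λ c → c)) ⟩
      + p * + p * (∑[ ab ∈ z ] diff ab * diff ab) - (+ p + 1ℤ) * (∑ z diff * ∑ z diff)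
    ∎
    where open ≡-Reasoning

-- Distances far from 1/√6

SumLt⇒< : ∀ {s e r} → SumLt s e r → s ℚ.+ e ℚ.* e ℚ.< r
SumLt⇒< {s} {e} {r} (0<r-s-e² , _) =
  subst₂ ℚ._<_ (ℚP.+-identityˡ (s ℚ.+ e ℚ.* e)) (cancel r s (e ℚ.* e)) (ℚP.+-monoˡ-< (s ℚ.+ e ℚ.* e) 0<r-s-e²)
  where
    open +-*-Solver
    cancel : ∀ r s t → r ℚ.- s ℚ.- t ℚ.+ (s ℚ.+ t) ≡ r
    cancel = solve 3 (λ r s t → r :- s :- t :+ (s :+ t) := r) refl

toℚᵘ-fromℤ*invℕ : ∀ m d → toℚᵘ (fromℤ m ℚ.* invℕ (suc d)) ≃ᵘ mkℚᵘ m 0 ℚᵘ.* mkℚᵘ 1ℤ d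
toℚᵘ-fromℤ*invℕ m d = ℚᵘP.≃-trans (ℚP.toℚᵘ-homo-* (fromℤ m) (invℕ (suc d)))
  (ℚᵘP.*-cong (ℚP.toℚᵘ-fromℚᵘ (mkℚᵘ m 0)) (ℚP.toℚᵘ-fromℚᵘ (mkℚᵘ 1ℤ d)))

1≤numerator : ∀ {ε} → 0ℚ ℚ.< ε → 1ℤ ≤ ℚ.↥ ε
1≤numerator {mkℚ a _ _} (ℚ.*<* 0<a*1) = ℤP.i<j⇒suc[i]≤j (subst (0ℤ <_) (ℤP.*-identityʳ a) 0<a*1)

module _ (ns : ℤ) (d : ℕ) where

  private
    D : ℤ
    D = + suc d

    k² : ℚ → ℤ
    k² ε = + ℚ.↧ₙ ε * + ℚ.↧ₙ ε

    toℚᵘ-ratio : toℚᵘ (fromℤ ns ℚ.* invℕ (suc d)) ≃ᵘ mkℚᵘ ns 0 ℚᵘ.* mkℚᵘ 1ℤ d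
    toℚᵘ-ratio = toℚᵘ-fromℤ*invℕ ns d

    toℚᵘ-sixth : toℚᵘ (+ 1 ℚ./ 6) ≃ᵘ mkℚᵘ 1ℤ 5
    toℚᵘ-sixth = ℚP.toℚᵘ-fromℚᵘ (mkℚᵘ 1ℤ 5)

    +D : + (1 ℕ.* suc d) ≡ D
    +D = cong +_ (ℕP.*-identityˡ (suc d))

    -- Between explicit fractions the order of ℚᵘ is, by definition, an inequality of cross products.
    unfold-above : ∀ a b → mkℚᵘ 1ℤ 5 ℚᵘ.+ mkℚᵘ a b ℚᵘ.* mkℚᵘ a b <ᵘ mkℚᵘ ns 0 ℚᵘ.* mkℚᵘ 1ℤ d →
                   (1ℤ * + (suc b ℕ.* suc b) + a * a * + 6) * + (1 ℕ.* suc d) < ns * 1ℤ * + (6 ℕ.* (suc b ℕ.* suc b))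
    unfold-above a b (*<* lt) = lt

    unfold-below : ∀ a b → mkℚᵘ ns 0 ℚᵘ.* mkℚᵘ 1ℤ d ℚᵘ.+ mkℚᵘ a b ℚᵘ.* mkℚᵘ a b <ᵘ mkℚᵘ 1ℤ 5 →
                   (ns * 1ℤ * + (suc b ℕ.* suc b) + a * a * + (1 ℕ.* suc d)) * + 6
                   < 1ℤ * + ((1 ℕ.* suc d) ℕ.* (suc b ℕ.* suc b))
    unfold-below a b (*<* lt) = lt

  above-sixth : ∀ ε → + 1 ℚ./ 6 ℚ.+ ε ℚ.* ε ℚ.< fromℤ ns ℚ.* invℕ (suc d) →
                + 6 * (ℚ.↥ ε * ℚ.↥ ε) * D < (+ 6 * ns - D) * k² ε
  above-sixth ε@(mkℚ a b _) s+ε²<r = subst (+ 6 * (a * a) * D <_) (factor ns D (k² ε)) (<-shift {k² ε * D} cleared)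
    where
      toℚᵘ-s+ε² : toℚᵘ (+ 1 ℚ./ 6 ℚ.+ ε ℚ.* ε) ≃ᵘ mkℚᵘ 1ℤ 5 ℚᵘ.+ mkℚᵘ a b ℚᵘ.* mkℚᵘ a b
      toℚᵘ-s+ε² = ℚᵘP.≃-trans (ℚP.toℚᵘ-homo-+ (+ 1 ℚ./ 6) (ε ℚ.* ε)) (ℚᵘP.+-cong toℚᵘ-sixth (ℚP.toℚᵘ-homo-* ε ε))
      raw : (1ℤ * + (suc b ℕ.* suc b) + a * a * + 6) * + (1 ℕ.* suc d) < ns * 1ℤ * + (6 ℕ.* (suc b ℕ.* suc b))
      raw = unfold-above a b (ℚᵘP.<-respʳ-≃ toℚᵘ-ratio (ℚᵘP.<-respˡ-≃ toℚᵘ-s+ε² (ℚP.toℚᵘ-mono-< s+ε²<r)))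
      expand : ∀ K a D → (1ℤ * K + a * a * + 6) * D ≡ K * D + + 6 * (a * a) * D
      expand = solve-∀
      cleared : k² ε * D + + 6 * (a * a) * D < ns * 1ℤ * (+ 6 * k² ε)
      cleared = subst₂ _<_ (trans (cong₂ (λ K E → (1ℤ * K + a * a * + 6) * E) (ℤP.pos-* (suc b) (suc b)) +D)
                                  (expand (k² ε) a D))
                           (cong (λ K → ns * 1ℤ * K)
                                 (trans (ℤP.pos-* 6 (suc b ℕ.* suc b)) (cong (+ 6 *_) (ℤP.pos-* (suc b) (suc b))))) raw
      factor : ∀ ns D K → ns * 1ℤ * (+ 6 * K) - K * D ≡ (+ 6 * ns - D) * K
      factor = solve-∀

  below-sixth : ∀ ε → fromℤ ns ℚ.* invℕ (suc d) ℚ.+ ε ℚ.* ε ℚ.< + 1 ℚ./ 6 →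
                + 6 * (ℚ.↥ ε * ℚ.↥ ε) * D < - ((+ 6 * ns - D) * k² ε)
  below-sixth ε@(mkℚ a b _) r+ε²<s = subst (+ 6 * (a * a) * D <_) (factor ns D (k² ε)) (<-shift {+ 6 * ns * k² ε} cleared)
    where
      toℚᵘ-r+ε² : toℚᵘ (fromℤ ns ℚ.* invℕ (suc d) ℚ.+ ε ℚ.* ε) ≃ᵘ mkℚᵘ ns 0 ℚᵘ.* mkℚᵘ 1ℤ d ℚᵘ.+ mkℚᵘ a b ℚᵘ.* mkℚᵘ a b
      toℚᵘ-r+ε² = ℚᵘP.≃-trans (ℚP.toℚᵘ-homo-+ (fromℤ ns ℚ.* invℕ (suc d)) (ε ℚ.* ε))
                             (ℚᵘP.+-cong toℚᵘ-ratio (ℚP.toℚᵘ-homo-* ε ε))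
      raw : (ns * 1ℤ * + (suc b ℕ.* suc b) + a * a * + (1 ℕ.* suc d)) * + 6
            < 1ℤ * + ((1 ℕ.* suc d) ℕ.* (suc b ℕ.* suc b))
      raw = unfold-below a b (ℚᵘP.<-respʳ-≃ toℚᵘ-sixth (ℚᵘP.<-respˡ-≃ toℚᵘ-r+ε² (ℚP.toℚᵘ-mono-< r+ε²<s)))
      expand : ∀ ns K a D → (ns * 1ℤ * K + a * a * D) * + 6 ≡ + 6 * ns * K + + 6 * (a * a) * D
      expand = solve-∀
      cleared : + 6 * ns * k² ε + + 6 * (a * a) * D < D * k² ε
      cleared = subst₂ _<_ (trans (cong₂ (λ K E → (ns * 1ℤ * K + a * a * E) * + 6) (ℤP.pos-* (suc b) (suc b)) +D)
                                  (expand ns (k² ε) a D))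
                           (trans (ℤP.*-identityˡ _) (trans (ℤP.pos-* (1 ℕ.* suc d) (suc b ℕ.* suc b))
                                                            (cong₂ _*_ +D (ℤP.pos-* (suc b) (suc b))))) raw
      factor : ∀ ns D K → D * K - + 6 * ns * K ≡ - ((+ 6 * ns - D) * K)
      factor = solve-∀

  far-from-sixth : ∀ ε → 0ℚ ℚ.< ε → SqrtFar (fromℤ ns ℚ.* invℕ (suc d)) (+ 1 ℚ./ 6) ε →
                   (+ 6 * D) * (+ 6 * D) ≤ ((+ 6 * ns - D) * k² ε) * ((+ 6 * ns - D) * k² ε)
  far-from-sixth ε 0<ε far = i≤∣j∣⇒i*i≤j*j 0≤6D
    (map-⊎ (6D≤ ∘ above-sixth ε ∘ SumLt⇒< {+ 1 ℚ./ 6} {ε} {r})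
           (6D≤ ∘ below-sixth ε ∘ SumLt⇒< {r} {ε} {+ 1 ℚ./ 6}) far)
    where
      0≤6D : 0ℤ ≤ + 6 * D
      0≤6D = +≤+ z≤n
      1≤a : 1ℤ ≤ ℚ.↥ ε
      1≤a = 1≤numerator 0<ε
      1≤a² : 1ℤ ≤ ℚ.↥ ε * ℚ.↥ ε
      1≤a² = *-mono-≤-nonNeg (+≤+ z≤n) (ℤP.≤-trans (+≤+ z≤n) 1≤a) 1≤a 1≤a
      r : ℚ
      r = fromℤ ns ℚ.* invℕ (suc d)
      6D≤ : ∀ {w} → + 6 * (ℚ.↥ ε * ℚ.↥ ε) * D < w → + 6 * D ≤ w
      6D≤ lt = ℤP.≤-trans (ℤP.*-monoʳ-≤-nonNeg D (ℤP.*-monoˡ-≤-nonNeg (+ 6) 1≤a²)) (ℤP.<⇒≤ lt)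

markov : ∀ {A : Set} {P : A → Set} (P? : Decidable P) (xs : List A) c (f : A → ℤ) →
         (∀ x → 0ℤ ≤ f x) → (∀ x → P x → c ≤ f x) → + length (filter P? xs) * c ≤ ∑ xs f
markov P? []       c f 0≤f c≤f = +≤+ z≤n
markov P? (x ∷ xs) c f 0≤f c≤f with P? x
... | yes px = ℤP.≤-trans (ℤP.≤-reflexive (ℤP.suc-* (+ length (filter P? xs)) c))
                          (ℤP.+-mono-≤ (c≤f x px) (markov P? xs c f 0≤f c≤f))
... | no _   = ℤP.≤-trans (ℤP.≤-reflexive (sym (ℤP.+-identityˡ _)))
                          (ℤP.+-mono-≤ (0≤f x) (markov P? xs c f 0≤f c≤f))

fromℕ*invℕ< : ∀ m n ε → 0ℚ ℚ.< ε → m ℕ.* ℚ.↧ₙ ε ℕ.< n → fromℕ m ℚ.* invℕ n ℚ.< ε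
fromℕ*invℕ< m (suc n) ε@(mkℚ a b _) 0<ε mk<n =
  ℚP.toℚᵘ-cancel-< (ℚᵘP.<-respˡ-≃ (ℚᵘP.≃-sym (toℚᵘ-fromℤ*invℕ (+ m) n)) (*<* cross))
  where
    open ℤP.≤-Reasoning
    cross : + m * 1ℤ * + suc b < a * + (1 ℕ.* suc n)
    cross = begin-strict
        + m * 1ℤ * + suc b
      ≡⟨ cong (_* + suc b) (ℤP.*-identityʳ (+ m)) ⟩
        + m * + suc b
      ≡⟨ sym (ℤP.pos-* m (suc b)) ⟩
        + (m ℕ.* suc b)
      <⟨ +<+ mk<n ⟩
        + suc n
      ≡⟨ sym (ℤP.*-identityˡ (+ suc n)) ⟩
        1ℤ * + suc n
      ≤⟨ ℤP.*-monoʳ-≤-nonNeg (+ suc n) (1≤numerator 0<ε) ⟩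
        a * + suc n
      ≡⟨ cong (λ k → a * + k) (sym (ℕP.*-identityˡ (suc n))) ⟩
        a * + (1 ℕ.* suc n)
      ∎

-- Counting the pairs far from 1/√6

module Estimate (K N n : ℤ) (1≤K : 1ℤ ≤ K) (108K<N : + 108 * K < N) (108K≤n : + 108 * K ≤ n) where

  p P₄ N₄ : ℤ
  p  = 1ℤ + n
  P₄ = p * p * p * p
  N₄ = N * N * N * N

  private
    0<1 : 0ℤ < 1ℤ
    0<1 = +<+ (s≤s z≤n)

    K≤108K : K ≤ + 108 * K
    K≤108K = ≤-by-gap (+ 107 * K) (0≤i*j {+ 107} (+≤+ z≤n) (ℤP.≤-trans (+≤+ z≤n) 1≤K)) (split K)
      where split : ∀ K → + 108 * K ≡ K + + 107 * K
            split = solve-∀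

    1≤n : 1ℤ ≤ n
    1≤n = ℤP.≤-trans 1≤K (ℤP.≤-trans K≤108K 108K≤n)

    1≤N : 1ℤ ≤ N
    1≤N = ℤP.<⇒≤ (ℤP.≤-<-trans 1≤K (ℤP.≤-<-trans K≤108K 108K<N))

    1≤p : 1ℤ ≤ p
    1≤p = ≤-by-gap n (ℤP.≤-trans (+≤+ z≤n) 1≤n) refl

    0<p 0<n 0<N : 0ℤ < _
    0<p = ℤP.<-≤-trans 0<1 1≤p
    0<n = ℤP.<-≤-trans 0<1 1≤n
    0<N = ℤP.<-≤-trans 0<1 1≤N

    0<P₄ : 0ℤ < P₄
    0<P₄ = 0<i*j (0<i*j (0<i*j 0<p 0<p) 0<p) 0<p

    0<N₄ : 0ℤ < N₄
    0<N₄ = 0<i*j (0<i*j (0<i*j 0<N 0<N) 0<N) 0<N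

  term₁ : K * (+ 1728 * P₄ * n * N₄) < + 192 * P₄ * (n * n) * N₄
  term₁ = subst₂ _<_ (regroup K P₄ n N₄) (regroup′ P₄ n N₄)
            (*-monoʳ-<-pos′ (+ 192 * P₄ * n * N₄) (0<i*j (0<i*j (0<i*j {+ 192} (+<+ (s≤s z≤n)) 0<P₄) 0<n) 0<N₄) 9K<n)
    where
      9K<n : + 9 * K < n
      9K<n = ℤP.<-≤-trans (<-by-gap (+ 99 * K) (0<i*j {+ 99} (+<+ (s≤s z≤n)) (ℤP.<-≤-trans 0<1 1≤K)) (split K))
                          108K≤n
        where split : ∀ K → + 108 * K ≡ + 9 * K + + 99 * K
              split = solve-∀
      regroup : ∀ K P n N → + 9 * K * (+ 192 * P * n * N) ≡ K * (+ 1728 * P * n * N)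
      regroup = solve-∀
      regroup′ : ∀ P n N → n * (+ 192 * P * n * N) ≡ + 192 * P * (n * n) * N
      regroup′ = solve-∀

  term₂ : K * (+ 48 * P₄ * (n * n) * (N * N)) < + 192 * P₄ * (n * n) * N₄
  term₂ = subst (K * c <_) (regroup P₄ n N) (*-monoʳ-<-pos′ c 0<c K<4N²)
    where
      c : ℤ
      c = + 48 * P₄ * (n * n) * (N * N)
      0<c : 0ℤ < c
      0<c = 0<i*j (0<i*j (0<i*j {+ 48} (+<+ (s≤s z≤n)) 0<P₄) (0<i*j 0<n 0<n)) (0<i*j 0<N 0<N)
      K<4N² : K < + 4 * (N * N)
      K<4N² = ℤP.<-≤-trans (ℤP.≤-<-trans K≤108K 108K<N) (ℤP.≤-trans (i≤i*i 1≤N)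
                (≤-by-gap (+ 3 * (N * N)) (0≤i*j {+ 3} (+≤+ z≤n) (0≤i*i N)) (split N)))
        where split : ∀ N → + 4 * (N * N) ≡ N * N + + 3 * (N * N)
              split = solve-∀
      regroup : ∀ P n N → + 4 * (N * N) * (+ 48 * P * (n * n) * (N * N)) ≡ + 192 * P * (n * n) * (N * N * N * N)
      regroup = solve-∀

  term₃ : K * (+ 5184 * ((p + 1ℤ) * (p + 1ℤ)) * (n * n) * N₄) < + 192 * P₄ * (n * n) * N₄
  term₃ = subst₂ _<_ (regroup K p n N₄) (regroup′ p n N₄) (*-monoʳ-<-pos′ c 0<c 27K[p+1]²<P₄)
    where
      c : ℤ
      c = + 192 * (n * n) * N₄
      0<c : 0ℤ < c
      0<c = 0<i*j (0<i*j {+ 192} (+<+ (s≤s z≤n)) (0<i*j 0<n 0<n)) 0<N₄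
      [p+1]²≤4p² : (p + 1ℤ) * (p + 1ℤ) ≤ + 4 * (p * p)
      [p+1]²≤4p² = ≤-by-gap ((p - 1ℤ) * (+ 3 * p + 1ℤ))
        (0≤i*j (ℤP.i≤j⇒0≤j-i 1≤p) (ℤP.+-mono-≤ (0≤i*j {+ 3} (+≤+ z≤n) (ℤP.<⇒≤ 0<p)) (+≤+ z≤n)))
        (split p)
        where split : ∀ p → + 4 * (p * p) ≡ (p + 1ℤ) * (p + 1ℤ) + (p - 1ℤ) * (+ 3 * p + 1ℤ)
              split = solve-∀
      108K<p² : + 108 * K < p * p
      108K<p² = ℤP.≤-<-trans 108K≤n (ℤP.<-≤-trans (<-by-gap 1ℤ 0<1 (ℤP.+-comm 1ℤ n)) (i≤i*i 1≤p))
      27K[p+1]²<P₄ : + 27 * K * ((p + 1ℤ) * (p + 1ℤ)) < P₄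
      27K[p+1]²<P₄ = begin-strict
          + 27 * K * ((p + 1ℤ) * (p + 1ℤ))
        ≤⟨ ℤP.*-monoˡ-≤-nonNeg (+ 27 * K) {{ℤ.nonNegative (0≤i*j {+ 27} (+≤+ z≤n) (ℤP.≤-trans (+≤+ z≤n) 1≤K))}}
                               [p+1]²≤4p² ⟩
          + 27 * K * (+ 4 * (p * p))
        ≡⟨ reassoc K p ⟩
          + 108 * K * (p * p)
        <⟨ *-monoʳ-<-pos′ (p * p) (0<i*j 0<p 0<p) 108K<p² ⟩
          p * p * (p * p)
        ≡⟨ square p ⟩
          P₄
        ∎
        where
          open ℤP.≤-Reasoning
          reassoc : ∀ K p → + 27 * K * (+ 4 * (p * p)) ≡ + 108 * K * (p * p)
          reassoc = solve-∀
          square : ∀ p → p * p * (p * p) ≡ p * p * p * p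
          square = solve-∀
      regroup : ∀ K p n N → + 27 * K * ((p + 1ℤ) * (p + 1ℤ)) * (+ 192 * (n * n) * N)
                          ≡ K * (+ 5184 * ((p + 1ℤ) * (p + 1ℤ)) * (n * n) * N)
      regroup = solve-∀
      regroup′ : ∀ p n N → p * p * p * p * (+ 192 * (n * n) * N) ≡ + 192 * (p * p * p * p) * (n * n) * N
      regroup′ = solve-∀

  estimate : K * (+ 1728 * P₄ * n * N₄ + + 48 * P₄ * (n * n) * (N * N) + + 5184 * ((p + 1ℤ) * (p + 1ℤ)) * (n * n) * N₄)
           < (+ 24 * (N * N) * (p * p) * n) * (+ 24 * (N * N) * (p * p) * n)
  estimate = subst₂ _<_ (distribute K _ _ _) (total p n N) (ℤP.+-mono-< (ℤP.+-mono-< term₁ term₂) term₃)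
    where
      distribute : ∀ K a b c → K * a + K * b + K * c ≡ K * (a + b + c)
      distribute = solve-∀
      total : ∀ p n N → + 192 * (p * p * p * p) * (n * n) * (N * N * N * N)
                        + + 192 * (p * p * p * p) * (n * n) * (N * N * N * N)
                        + + 192 * (p * p * p * p) * (n * n) * (N * N * N * N)
                      ≡ (+ 24 * (N * N) * (p * p) * n) * (+ 24 * (N * N) * (p * p) * n)
      total = solve-∀

module ExcessOfNorm {n : ℕ} (isPrime : Prime (suc n)) (N : ℕ) where
  open CoefficientRange N
  open CoefficientDifferences N
  open ResiduesModPrime isPrime using (p)
  open NormsModPrime isPrime using (normSq-difference)

  private
    T : ℤ
    T = + 12 * (+ N * + N)
    P P₄ : ℤ
    P  = + p
    P₄ = P * P * P * P
    module G = MomentsOfSums pairs diff ∑-diff ((+ 2 * + N) * (+ 2 * + N)) (0≤i*i (+ 2 * + N)) diff²≤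
    module H = MomentsOfSums pairs centredSquare ∑-centredSquare (T * T) (0≤i*i T) centredSquare²≤

  D : ℤ
  D = + 4 * (+ N * + N) * (P * P) * + n

  -- D · (6 𝔡(α, β)² - 1), where D is the denominator of normDistSq
  excess : Elt × Elt → ℤ
  excess (α , β) = + 6 * normSq p (subE α β) - D

  count : ℤ
  count = + length (tuplesOf pairs n)

  excessBound : ℤ
  excessBound = + 1728 * P₄ * + n * (+ N * + N * + N * + N) + + 48 * P₄ * (+ n * + n) * (+ N * + N)
              + + 5184 * ((P + 1ℤ) * (P + 1ℤ)) * (+ n * + n) * (+ N * + N * + N * + N)

  private
    ∑-centredSquare-tuple : ∀ (z : List (ℤ × ℤ)) →
      ∑ z centredSquare ≡ + 3 * (∑[ ab ∈ z ] diff ab * diff ab) - + length z * c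
    ∑-centredSquare-tuple z = begin
        ∑ z centredSquare
      ≡⟨ ∑-distrib-+ z (λ ab → + 3 * (diff ab * diff ab)) (λ _ → - c) ⟩
        ∑ z (λ ab → + 3 * (diff ab * diff ab)) + ∑ z (λ _ → - c)
      ≡⟨ cong₂ _+_ (∑-*ˡ z (+ 3) (λ ab → diff ab * diff ab))
                   (trans (∑-const z (- c)) (sym (ℤP.neg-distribʳ-* (+ length z) c))) ⟩
        + 3 * (∑[ ab ∈ z ] diff ab * diff ab) - + length z * c
      ∎
      where open ≡-Reasoning

  excess-tuple : ∀ z → length z ≡ n → excess (toEltPair z)
    ≡ + 2 * (P * P) * ∑ z centredSquare + + 4 * (P * P) * + n * + N - + 6 * (P + 1ℤ) * (∑ z diff * ∑ z diff)
  excess-tuple z length≡n = begin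
      + 6 * normSq p (subE (toElt (map proj₁ z)) (toElt (map proj₂ z))) - D
    ≡⟨ cong (λ q → + 6 * q - D) (normSq-difference z length≡n) ⟩
      + 6 * (P * P * Q - (P + 1ℤ) * (S * S)) - D
    ≡⟨ regroup (+ n) (+ N) Q S ⟩
      + 2 * (P * P) * (+ 3 * Q - + n * c) + + 4 * (P * P) * + n * + N - + 6 * (P + 1ℤ) * (S * S)
    ≡⟨ cong (λ t → + 2 * (P * P) * t + + 4 * (P * P) * + n * + N - + 6 * (P + 1ℤ) * (S * S))
            (sym (trans (∑-centredSquare-tuple z) (cong (λ l → + 3 * Q - + l * c) length≡n))) ⟩
      + 2 * (P * P) * ∑ z centredSquare + + 4 * (P * P) * + n * + N - + 6 * (P + 1ℤ) * (S * S)
    ∎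
    where
      open ≡-Reasoning
      Q S : ℤ
      Q = ∑[ ab ∈ z ] diff ab * diff ab
      S = ∑ z diff
      regroup : ∀ n N q s → let P = 1ℤ + n in
                + 6 * (P * P * q - (P + 1ℤ) * (s * s)) - + 4 * (N * N) * (P * P) * n
              ≡ + 2 * (P * P) * (+ 3 * q - n * (+ 2 * N * (N + 1ℤ))) + + 4 * (P * P) * n * N - + 6 * (P + 1ℤ) * (s * s)
      regroup = solve-∀

  private
    tupleBound : List (ℤ × ℤ) → ℤ
    tupleBound z = + 12 * P₄ * (∑ z centredSquare * ∑ z centredSquare) + + 48 * P₄ * (+ n * + n) * (+ N * + N)
                 + + 108 * ((P + 1ℤ) * (P + 1ℤ)) * (∑ z diff * ∑ z diff * ∑ z diff * ∑ z diff)

    excess²≤tupleBound : ∀ z → length z ≡ n →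
      excess (toEltPair z) * excess (toEltPair z) ≤ tupleBound z
    excess²≤tupleBound z length≡n =
      subst₂ _≤_ (cong (λ t → t * t) (sym (excess-tuple z length≡n))) (expand P (+ n) (+ N) (∑ z centredSquare) (∑ z diff))
        ([i+j+k]²≤3[i²+j²+k²] (+ 2 * (P * P) * ∑ z centredSquare) (+ 4 * (P * P) * + n * + N)
                               (- (+ 6 * (P + 1ℤ) * (∑ z diff * ∑ z diff))))
      where
        expand : ∀ P n N h s → + 3 * ((+ 2 * (P * P) * h) * (+ 2 * (P * P) * h) + (+ 4 * (P * P) * n * N) * (+ 4 * (P * P) * n * N)
                                   + - (+ 6 * (P + 1ℤ) * (s * s)) * - (+ 6 * (P + 1ℤ) * (s * s)))
                             ≡ + 12 * (P * P * P * P) * (h * h) + + 48 * (P * P * P * P) * (n * n) * (N * N)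
                               + + 108 * ((P + 1ℤ) * (P + 1ℤ)) * (s * s * s * s)
        expand = solve-∀

  ∑-excess²≤ : ∑ (cartesianProduct (Bset p N) (Bset p N)) (λ x → excess x * excess x) ≤ excessBound * count
  ∑-excess²≤ = begin
      ∑ (cartesianProduct (Bset p N) (Bset p N)) (λ x → excess x * excess x)
    ≡⟨ ∑-Bset² p N (λ x → excess x * excess x) ⟩
      ∑[ z ∈ tuplesOf pairs n ] excess (toEltPair z) * excess (toEltPair z)
    ≤⟨ ∑-mono-≤ (tuplesOf pairs n) (λ z z∈ → excess²≤tupleBound z (∈-tuplesOf⁻ {L = pairs} z∈)) ⟩
      ∑ (tuplesOf pairs n) tupleBound
    ≡⟨ split ⟩
      + 12 * P₄ * (∑[ z ∈ tuplesOf pairs n ] ∑ z centredSquare * ∑ z centredSquare)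
      + + 48 * P₄ * (+ n * + n) * (+ N * + N) * count
      + + 108 * ((P + 1ℤ) * (P + 1ℤ)) * (∑[ z ∈ tuplesOf pairs n ] ∑ z diff * ∑ z diff * ∑ z diff * ∑ z diff)
    ≤⟨ ℤP.+-mono-≤ (ℤP.+-monoˡ-≤ _ (ℤP.*-monoˡ-≤-nonNeg (+ 12 * P₄) {{ℤ.nonNegative 0≤12P₄}} (H.moment₂≤ n)))
                   (ℤP.*-monoˡ-≤-nonNeg (+ 108 * ((P + 1ℤ) * (P + 1ℤ))) {{ℤ.nonNegative 0≤108[P+1]²}} (G.moment₄≤ n)) ⟩
      + 12 * P₄ * (+ n * (T * T) * count) + + 48 * P₄ * (+ n * + n) * (+ N * + N) * count
      + + 108 * ((P + 1ℤ) * (P + 1ℤ)) * (+ 3 * + n * + n * (((+ 2 * + N) * (+ 2 * + N)) * ((+ 2 * + N) * (+ 2 * + N))) * count)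
    ≡⟨ collect P (+ n) (+ N) count ⟩
      excessBound * count
    ∎
    where
      open ℤP.≤-Reasoning
      0≤12P₄ : 0ℤ ≤ + 12 * P₄
      0≤12P₄ = +≤+ z≤n
      0≤108[P+1]² : 0ℤ ≤ + 108 * ((P + 1ℤ) * (P + 1ℤ))
      0≤108[P+1]² = 0≤i*j {+ 108} (+≤+ z≤n) (0≤i*i (P + 1ℤ))
      Tz : List (List (ℤ × ℤ))
      Tz = tuplesOf pairs n
      H² G⁴ : List (ℤ × ℤ) → ℤ
      H² z = ∑ z centredSquare * ∑ z centredSquare
      G⁴ z = ∑ z diff * ∑ z diff * ∑ z diff * ∑ z diff
      c₂ : ℤ
      c₂ = + 48 * P₄ * (+ n * + n) * (+ N * + N)
      split : ∑ Tz tupleBound ≡ + 12 * P₄ * ∑ Tz H² + c₂ * count + + 108 * ((P + 1ℤ) * (P + 1ℤ)) * ∑ Tz G⁴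
      split = trans (∑-distrib-+ Tz (λ z → + 12 * P₄ * H² z + c₂) (λ z → + 108 * ((P + 1ℤ) * (P + 1ℤ)) * G⁴ z))
        (cong₂ _+_ (trans (∑-distrib-+ Tz (λ z → + 12 * P₄ * H² z) (λ _ → c₂))
                          (cong₂ _+_ (∑-*ˡ Tz (+ 12 * P₄) H²) (trans (∑-const Tz c₂) (ℤP.*-comm count c₂))))
                   (∑-*ˡ Tz (+ 108 * ((P + 1ℤ) * (P + 1ℤ))) G⁴))
      collect : ∀ P n N C → + 12 * (P * P * P * P) * (n * ((+ 12 * (N * N)) * (+ 12 * (N * N))) * C)
                            + + 48 * (P * P * P * P) * (n * n) * (N * N) * C
                            + + 108 * ((P + 1ℤ) * (P + 1ℤ)) * (+ 3 * n * n * (((+ 2 * N) * (+ 2 * N)) * ((+ 2 * N) * (+ 2 * N))) * C)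
                          ≡ (+ 1728 * (P * P * P * P) * n * (N * N * N * N) + + 48 * (P * P * P * P) * (n * n) * (N * N)
                            + + 5184 * ((P + 1ℤ) * (P + 1ℤ)) * (n * n) * (N * N * N * N)) * C
      collect = solve-∀

  0<count : 0ℤ < count
  0<count = 0<length-tuplesOf pairs n (+<+ (s≤s z≤n))

  count≡|B|² : count ≡ + (length (Bset p N) ℕ.* length (Bset p N))
  count≡|B|² = begin
      + length (tuplesOf pairs n)
    ≡⟨ length≡∑1 (tuplesOf pairs n) ⟩
      ∑[ z ∈ tuplesOf pairs n ] 1ℤ
    ≡⟨ sym (∑-Bset² p N (λ _ → 1ℤ)) ⟩
      ∑ (cartesianProduct (Bset p N) (Bset p N)) (λ _ → 1ℤ)
    ≡⟨ ∑-cartesianProduct (Bset p N) (Bset p N) (λ _ → 1ℤ) ⟩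
      ∑[ α ∈ Bset p N ] ∑[ β ∈ Bset p N ] 1ℤ
    ≡⟨ ∑-cong (Bset p N) (λ _ → sym (length≡∑1 (Bset p N))) ⟩
      ∑[ α ∈ Bset p N ] + length (Bset p N)
    ≡⟨ ∑-const (Bset p N) (+ length (Bset p N)) ⟩
      + length (Bset p N) * + length (Bset p N)
    ≡⟨ sym (ℤP.pos-* (length (Bset p N)) (length (Bset p N))) ⟩
      + (length (Bset p N) ℕ.* length (Bset p N))
    ∎
    where open ≡-Reasoning

-- ε ≥ 1/k for the denominator k of ε, so it suffices to push the bad proportion below 1/k.
threshold : ℚ → ℕ
threshold ε = 108 ℕ.* (k ℕ.* k ℕ.* k ℕ.* k ℕ.* k)
  where k : ℕ
        k = ℚ.↧ₙ ε

pos-⁵ : ∀ k → + (k ℕ.* k ℕ.* k ℕ.* k ℕ.* k) ≡ + k * + k * + k * + k * + k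
pos-⁵ k = begin
    + (k ℕ.* k ℕ.* k ℕ.* k ℕ.* k)
  ≡⟨ ℤP.pos-* (k ℕ.* k ℕ.* k ℕ.* k) k ⟩
    + (k ℕ.* k ℕ.* k ℕ.* k) * + k
  ≡⟨ cong (_* + k) (ℤP.pos-* (k ℕ.* k ℕ.* k) k) ⟩
    + (k ℕ.* k ℕ.* k) * + k * + k
  ≡⟨ cong (λ t → t * + k * + k) (ℤP.pos-* (k ℕ.* k) k) ⟩
    + (k ℕ.* k) * + k * + k * + k
  ≡⟨ cong (λ t → t * + k * + k * + k) (ℤP.pos-* k k) ⟩
    + k * + k * + k * + k * + k
  ∎
  where open ≡-Reasoning

module Counting (ε : ℚ) (0<ε : 0ℚ ℚ.< ε) (n N : ℕ) (isPrime : Prime (suc (suc n)))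
                (A<N : threshold ε ℕ.< suc N) (A<p : threshold ε ℕ.< suc (suc n)) where

  open ExcessOfNorm isPrime (suc N)

  private
    p : ℕ
    p = suc (suc n)

    K K⁵ : ℤ
    K  = + ℚ.↧ₙ ε
    K⁵ = K * K * K * K * K

    pairs² : List (Elt × Elt)
    pairs² = cartesianProduct (Bset p (suc N)) (Bset p (suc N))

    nBad : ℕ
    nBad = length (filter (Bad? p (suc N) ε) pairs²)

    d : ℕ
    d = ℕ.pred (4 ℕ.* (suc N ℕ.* suc N) ℕ.* (p ℕ.* p) ℕ.* suc n)

    +suc-d≡D : + suc d ≡ D
    +suc-d≡D = trans (ℤP.pos-* (4 ℕ.* (suc N ℕ.* suc N) ℕ.* (p ℕ.* p)) (suc n))
      (cong (_* + suc n) (trans (ℤP.pos-* (4 ℕ.* (suc N ℕ.* suc N)) (p ℕ.* p))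
        (cong₂ _*_ (trans (ℤP.pos-* 4 (suc N ℕ.* suc N)) (cong (+ 4 *_) (ℤP.pos-* (suc N) (suc N))))
                   (ℤP.pos-* p p))))

    bad⇒ : ∀ x → Bad p (suc N) ε x → (+ 6 * D) * (+ 6 * D) ≤ (excess x * (K * K)) * (excess x * (K * K))
    bad⇒ (α , β) isBad =
      subst (λ t → (+ 6 * t) * (+ 6 * t) ≤ ((+ 6 * w - t) * (K * K)) * ((+ 6 * w - t) * (K * K)))
            +suc-d≡D (far-from-sixth w d ε 0<ε isBad)
      where w : ℤ
            w = normSq p (subE α β)

    +A≡108K⁵ : + threshold ε ≡ + 108 * K⁵
    +A≡108K⁵ = trans (ℤP.pos-* 108 (k ℕ.* k ℕ.* k ℕ.* k ℕ.* k)) (cong (+ 108 *_) (pos-⁵ k))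
      where k : ℕ
            k = ℚ.↧ₙ ε

    open Estimate K⁵ (+ suc N) (+ suc n)
           (+≤+ (s≤s z≤n))
           (subst (ℤ._< + suc N) +A≡108K⁵ (+<+ A<N))
           (subst (ℤ._≤ + suc n) +A≡108K⁵ (+≤+ (ℕP.≤-pred A<p)))
      using (estimate)

  nBad*K<count : + nBad * K < count
  nBad*K<count = ℤP.*-cancelʳ-<-nonNeg ((+ 6 * D) * (+ 6 * D)) {{ℤ.nonNegative (0≤i*i (+ 6 * D))}} (begin-strict
      + nBad * K * ((+ 6 * D) * (+ 6 * D))
    ≡⟨ swap (+ nBad) K _ ⟩
      K * (+ nBad * ((+ 6 * D) * (+ 6 * D)))
    ≤⟨ ℤP.*-monoˡ-≤-nonNeg K
         (markov (Bad? p (suc N) ε) pairs² _ excessK² (λ x → 0≤i*i (excess x * (K * K))) bad⇒) ⟩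
      K * ∑ pairs² excessK²
    ≡⟨ cong (K *_) (trans (∑-cong pairs² (λ x → regroup (excess x) K))
                          (∑-*ˡ pairs² (K * K * (K * K)) (λ x → excess x * excess x))) ⟩
      K * (K * K * (K * K) * ∑ pairs² (λ x → excess x * excess x))
    ≡⟨ sym (ℤP.*-assoc K (K * K * (K * K)) _) ⟩
      K * (K * K * (K * K)) * ∑ pairs² (λ x → excess x * excess x)
    ≤⟨ ℤP.*-monoˡ-≤-nonNeg (K * (K * K * (K * K))) {{ℤ.nonNegative (+≤+ z≤n)}} ∑-excess²≤ ⟩
      K * (K * K * (K * K)) * (excessBound * count)
    ≡⟨ reassoc K excessBound count ⟩
      K⁵ * excessBound * count
    <⟨ ℤP.*-monoʳ-<-pos count {{ℤ.positive 0<count}}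
         (subst (K⁵ * excessBound <_) (six-D (+ suc N) (+ p) (+ suc n)) estimate) ⟩
      (+ 6 * D) * (+ 6 * D) * count
    ≡⟨ ℤP.*-comm _ count ⟩
      count * ((+ 6 * D) * (+ 6 * D))
    ∎)
    where
      open ℤP.≤-Reasoning
      excessK² : Elt × Elt → ℤ
      excessK² x = (excess x * (K * K)) * (excess x * (K * K))
      swap : ∀ b k t → b * k * t ≡ k * (b * t)
      swap = solve-∀
      regroup : ∀ e k → (e * (k * k)) * (e * (k * k)) ≡ k * k * (k * k) * (e * e)
      regroup = solve-∀
      reassoc : ∀ k b c → k * (k * k * (k * k)) * (b * c) ≡ k * k * k * k * k * b * c
      reassoc = solve-∀
      six-D : ∀ N P n → (+ 24 * (N * N) * (P * P) * n) * (+ 24 * (N * N) * (P * P) * n)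
                      ≡ (+ 6 * (+ 4 * (N * N) * (P * P) * n)) * (+ 6 * (+ 4 * (N * N) * (P * P) * n))
      six-D = solve-∀

  badProportion<ε : badProportion p (suc N) ε ℚ.< ε
  badProportion<ε = fromℕ*invℕ< nBad (length (Bset p (suc N)) ℕ.* length (Bset p (suc N))) ε 0<ε
    (ℤP.drop‿+<+ (subst₂ _<_ (sym (ℤP.pos-* nBad (ℚ.↧ₙ ε))) count≡|B|² nBad*K<count))

theorem1p1 : (ε : ℚ) → 0ℚ ℚ.< ε →
    Σ ℕ (λ A → (p N : ℕ) → Prime p → ¬ (2 ∣ p) → A ℕ.< N → A ℕ.< p →
      badProportion p N ε ℚ.< ε)
theorem1p1 ε 0<ε = threshold ε , bound
  where
    -- The argument works for every prime p.
    bound : (p N : ℕ) → Prime p → ¬ (2 ∣ p) → threshold ε ℕ.< N → threshold ε ℕ.< p →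
            badProportion p N ε ℚ.< ε
    bound (suc (suc n)) (suc N) isPrime _ A<N A<p = Counting.badProportion<ε ε 0<ε n N isPrime A<N A<p
    bound (suc zero)    _       isPrime _ _   _   = ⊥-elim (¬prime[1] isPrime)
    bound zero          _       _       _ _   ()
    bound (suc (suc n)) zero    _       _ ()  _
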